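{- Let $\Gamma$ be a signed cactus graph with cyclomatic number $\beta$, and let $e$ be an edge lying on some cycle of $\Gamma$. (1) If $m^+(C)=m^-(C)$ for every cycle $C$ of $\Gamma$, then $\eta(\Gamma-e)=\eta(\Gamma)-1$. (2) If $m^+(C)\neq m^-(C)$ for every cycle $C$ of $\Gamma$, then $\eta(\Gamma-e)=\eta(\Gamma)=1$.
   Context: A signed graph $\Gamma=(G,\sigma)$ is a simple graph $G$ with a sign function $\sigma:E(G)\to\{ -1,+1\}$. A cactus graph is a connected graph in which any two cycles share no edge; a signed cactus graph is a signed graph whose underlying graph is a cactus graph. The cyclomatic number is $\beta(\Gamma)=|E(\Gamma)|-|V(\Gamma)|+1$. The net Laplacian matrix is $L^{\pm}(\Gamma)=D^{\pm}(\Gamma)-A(\Gamma)$, where $D^{\pm}(\Gamma)$ is the diagonal matrix of net-degrees $d^{\pm}(v)=d^+(v)-d^-(v)$ (numbers of positive minus negative neighbours) and $A(\Gamma)$ is the signed adjacency matrix. $\eta(\Gamma)$ is the multiplicity of $0$ as an eigenvalue of $L^{\pm}(\Gamma)$. $\Gamma-e$ is obtained by deleting the edge $e$. For a cycle $C$, $m^+(C)$ and $m^-(C)$ are the numbers of positive and negative edges of $C$. -}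

module Defs where

open import Data.Nat using (ℕ; zero; suc; _≤_)
open import Data.Fin using (Fin; zero; suc)
import Data.Fin as F
open import Data.Bool using (Bool; true; false; if_then_else_; _∧_; _∨_)
open import Data.Integer using (ℤ; +_; -_) renaming (_+_ to _+ℤ_; _-_ to _-ℤ_; _*_ to _*ℤ_)
import Data.Integer as ℤ
open import Data.Rational using (ℚ; 0ℚ; _/_) renaming (_+_ to _+ℚ_; _*_ to _*ℚ_)
open import Data.Product using (Σ; ∃; ∃-syntax; _×_; _,_)
open import Data.Sum using (_⊎_)
open import Relation.Nullary using (¬_; yes; no)
open import Relation.Nullary.Decidable using (⌊_⌋)
open import Relation.Binary.PropositionalEquality using (_≡_; _≢_)
open import Function.Bundles using (_⇔_)

sumℤ : ∀ {n} → (Fin n → ℤ) → ℤ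
sumℤ {zero}  f = + 0
sumℤ {suc n} f = f zero +ℤ sumℤ (λ i → f (suc i))

sumℚ : ∀ {n} → (Fin n → ℚ) → ℚ
sumℚ {zero}  f = 0ℚ
sumℚ {suc n} f = f zero +ℚ sumℚ (λ i → f (suc i))

countEq : ∀ {n} → (Fin n → ℤ) → ℤ → ℕ
countEq {zero}  f z = 0
countEq {suc n} f z with f zero ℤ.≟ z
... | yes _ = suc (countEq (λ i → f (suc i)) z)
... | no  _ = countEq (λ i → f (suc i)) z

-- Signed graphs on the vertex set Fin n, represented by their signed
-- adjacency matrix A : A i j = +1 (positive edge), -1 (negative edge),
-- 0 (no edge).

Mat : ℕ → Set
Mat n = Fin n → Fin n → ℤ

IsSignedGraph : ∀ {n} → Mat n → Set
IsSignedGraph {n} A =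
  (∀ i j → A i j ≡ A j i) ×
  (∀ i → A i i ≡ + 0) ×
  (∀ i j → A i j ≡ + 0 ⊎ A i j ≡ + 1 ⊎ A i j ≡ - (+ 1))

Adj : ∀ {n} → Mat n → Fin n → Fin n → Set
Adj A i j = A i j ≢ + 0

deleteEdge : ∀ {n} → Mat n → Fin n → Fin n → Mat n
deleteEdge A u v i j =
  if (⌊ i F.≟ u ⌋ ∧ ⌊ j F.≟ v ⌋) ∨ (⌊ i F.≟ v ⌋ ∧ ⌊ j F.≟ u ⌋)
  then + 0 else A i j

Connected : ∀ {n} → Mat n → Set
Connected {n} A = ∀ (x y : Fin n) →
  ∃[ l ] Σ (Fin (suc l) → Fin n) λ w →
    w zero ≡ x × w (F.fromℕ l) ≡ y × (∀ (k : Fin l) → Adj A (w (F.inject₁ k)) (w (suc k)))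

-- Cycles.  A cycle of length suc m (≥ 3) is an injective sequence of
-- vertices vs 0, …, vs m with vs i adjacent to vs (cnext i), where
-- cnext is the cyclic successor on Fin (suc m).

cnext : ∀ {m} → Fin (suc m) → Fin (suc m)
cnext {zero}  zero    = zero
cnext {suc m} zero    = suc zero
cnext {suc m} (suc i) with cnext {m} i
... | zero  = zero
... | suc j = suc (suc j)

record Cycle {n : ℕ} (A : Mat n) : Set where
  field
    m     : ℕ
    len≥3 : 3 ≤ suc m
    vs    : Fin (suc m) → Fin n
    inj   : ∀ i j → vs i ≡ vs j → i ≡ j
    adj   : ∀ i → Adj A (vs i) (vs (cnext i))
open Cycle public

EdgeOf : ∀ {n} {A : Mat n} → Cycle A → Fin n → Fin n → Set
EdgeOf C u v = ∃[ i ] ((vs C i ≡ u × vs C (cnext i) ≡ v) ⊎ (vs C i ≡ v × vs C (cnext i) ≡ u))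

edgeSign : ∀ {n} {A : Mat n} (C : Cycle A) → Fin (suc (m C)) → ℤ
edgeSign {A = A} C i = A (vs C i) (vs C (cnext i))

m⁺ : ∀ {n} {A : Mat n} → Cycle A → ℕ
m⁺ C = countEq (edgeSign C) (+ 1)

m⁻ : ∀ {n} {A : Mat n} → Cycle A → ℕ
m⁻ C = countEq (edgeSign C) (- (+ 1))

-- cactus: connected, and two cycles sharing an edge are the same cycle
-- (same edge set), i.e. distinct cycles share no edge.
IsCactus : ∀ {n} → Mat n → Set
IsCactus {n} A = Connected A ×
  (∀ (C₁ C₂ : Cycle A) → (∃[ u ] ∃[ v ] (EdgeOf C₁ u v × EdgeOf C₂ u v)) →
     ∀ u v → EdgeOf C₁ u v ⇔ EdgeOf C₂ u v)

netDeg : ∀ {n} → Mat n → Fin n → ℤ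
netDeg A v = sumℤ (A v)

netLaplacian : ∀ {n} → Mat n → Mat n
netLaplacian A i j = (if ⌊ i F.≟ j ⌋ then netDeg A i else + 0) -ℤ A i j

-- Nullity η(M): multiplicity of 0 as an eigenvalue of the (real symmetric,
-- integer) matrix M, i.e. the dimension of its kernel (over ℚ; an integer
-- matrix has the same nullity over ℚ and ℝ).

toℚ : ℤ → ℚ
toℚ z = z / 1

Vecℚ : ℕ → Set
Vecℚ n = Fin n → ℚ

mulVec : ∀ {n} → Mat n → Vecℚ n → Vecℚ n
mulVec M x i = sumℚ (λ j → toℚ (M i j) *ℚ x j)

InKernel : ∀ {n} → Mat n → Vecℚ n → Set
InKernel M x = ∀ i → mulVec M x i ≡ 0ℚ

lincomb : ∀ {n k} → (Fin k → ℚ) → (Fin k → Vecℚ n) → Vecℚ n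
lincomb c b j = sumℚ (λ t → c t *ℚ b t j)

HasNullity : ∀ {n} → Mat n → ℕ → Set
HasNullity {n} M k = Σ (Fin k → Vecℚ n) λ b →
  (∀ t → InKernel M (b t)) ×
  (∀ (c : Fin k → ℚ) → (∀ j → lincomb c b j ≡ 0ℚ) → ∀ t → c t ≡ 0ℚ) ×
  (∀ x → InKernel M x → Σ (Fin k → ℚ) λ c → ∀ j → x j ≡ lincomb c b j)

-- Since (L± x)_i = Σ_k A_ik (x_i − x_k), for x in ker L± the flow A_ik (x_i − x_k) from i to k is
-- antisymmetric and sums to zero at every vertex, so its net amount out of any vertex set vanishes.
-- In a cactus the vertices of a cycle C lie in different components once the edges of C are removed
-- (a walk joining two of them would close up, with an arc of C, to a second cycle through an edge of C),
-- so cutting off the component at each vertex of C shows that the flow is a constant D along C: x drops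
-- by σ_l D along the l-th edge, and summing around C gives D (m⁺ − m⁻) = 0.  In Γ − e the flow vanishes
-- at the deleted edge, hence along its whole cycle, so x_u = x_v and ker L±(Γ − e) is the hyperplane
-- x_u = x_v of ker L±(Γ).  If all cycles are unbalanced, D = 0 on every cycle and bridges carry no flow,
-- so both kernels consist of the constants.  If all cycles are balanced, the potential rising by σ_l
-- along C and constant on the components hanging off C lies in ker L±(Γ) but not in the hyperplane,
-- so the nullity drops by exactly one.

module Submission where

open import Defs
open import Data.Nat as ℕ using (ℕ; zero; suc)
open import Data.Fin as F using (Fin; zero; suc; punchIn; punchOut; inject₁; fromℕ)
open import Data.Fin.Properties using (punchInᵢ≢i; punchIn-punchOut; punchOut-punchIn; punchOut-cong; any?)
open import Data.Vec.Functional using (insertAt)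
open import Data.Vec.Functional.Properties using (insertAt-lookup; insertAt-punchIn)
open import Data.Integer as ℤ using (ℤ; 0ℤ; 1ℤ; -1ℤ)
import Data.Integer.Properties as ℤP
open import Data.Rational as ℚ using (ℚ; 0ℚ; 1ℚ; _+_; _*_; -_; _-_; 1/_; toℚᵘ)
import Data.Rational.Properties as ℚP
open import Data.Rational.Unnormalised as ℚᵘ using (mkℚᵘ; *≡*) renaming (_≃_ to _≃ᵘ_)
import Data.Rational.Unnormalised.Properties as ℚᵘP
open import Data.Rational.Solver using (module +-*-Solver)
open import Data.Product using (Σ; ∃; _×_; _,_; proj₁; proj₂)
open import Data.Sum using (_⊎_; inj₁; inj₂)
open import Data.Empty using (⊥; ⊥-elim)
open import Relation.Nullary using (¬_; Dec; yes; no)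
open import Relation.Nullary.Negation using (contradiction)
open import Relation.Binary.PropositionalEquality
  using (_≡_; _≢_; refl; sym; trans; cong; cong₂; subst; subst₂; module ≡-Reasoning)
open import Function using (_∘_; id)
open import Algebra.Bundles using (Ring)

open +-*-Solver using (solve; _:+_; _:*_; :-_; _:-_; _:=_)

module RationalFacts where

  open import Algebra.Properties.Group ℚP.+-0-group public
    using () renaming (x∙y⁻¹≈ε⇒x≈y to p-q≡0⇒p≡q; x≈y⇒x∙y⁻¹≈ε to p≡q⇒p-q≡0)

  p≢0∧p*q≡0⇒q≡0 : ∀ {p q} → p ≢ 0ℚ → p * q ≡ 0ℚ → q ≡ 0ℚ
  p≢0∧p*q≡0⇒q≡0 {p} {q} p≢0 pq≡0 = begin
    q                ≡⟨ sym (ℚP.*-identityˡ q) ⟩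
    1ℚ * q           ≡⟨ cong (_* q) (sym (ℚP.*-inverseˡ p)) ⟩
    (1/ p * p) * q   ≡⟨ ℚP.*-assoc (1/ p) p q ⟩
    1/ p * (p * q)   ≡⟨ cong (1/ p *_) pq≡0 ⟩
    1/ p * 0ℚ        ≡⟨ ℚP.*-zeroʳ (1/ p) ⟩
    0ℚ               ∎
    where
    open ≡-Reasoning
    instance
      p-nonZero : ℚ.NonZero p
      p-nonZero = ℚ.≢-nonZero p≢0

  p≡-p⇒p≡0 : ∀ p → p ≡ - p → p ≡ 0ℚ
  p≡-p⇒p≡0 p p≡-p = begin
    p                ≡⟨ solve 1 (λ p → p := (p :+ p) :* con ℚ.½) refl p ⟩
    (p + p) * ℚ.½    ≡⟨ cong (λ w → (p + w) * ℚ.½) p≡-p ⟩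
    (p + - p) * ℚ.½  ≡⟨ cong (_* ℚ.½) (ℚP.+-inverseʳ p) ⟩
    0ℚ * ℚ.½         ≡⟨ ℚP.*-zeroˡ ℚ.½ ⟩
    0ℚ               ∎
    where
    open ≡-Reasoning
    open +-*-Solver using (con)

  -- toℚ z = z / 1 normalises, so its homomorphism laws are proved in ℚᵘ.
  toℚᵘ-toℚ : ∀ z → toℚᵘ (toℚ z) ≃ᵘ mkℚᵘ z 0
  toℚᵘ-toℚ z = ℚP.toℚᵘ-fromℚᵘ (mkℚᵘ z 0)

  toℚ-+ : ∀ a b → toℚ (a ℤ.+ b) ≡ toℚ a + toℚ b
  toℚ-+ a b = ℚP.toℚᵘ-injective (begin-equality
    toℚᵘ (toℚ (a ℤ.+ b))                ≃⟨ toℚᵘ-toℚ (a ℤ.+ b) ⟩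
    mkℚᵘ (a ℤ.+ b) 0                    ≃⟨ *≡* (cong (ℤ._* ℤ.1ℤ) (sym (cong₂ ℤ._+_ (ℤP.*-identityʳ a)
                                                                                  (ℤP.*-identityʳ b)))) ⟩
    mkℚᵘ a 0 ℚᵘ.+ mkℚᵘ b 0              ≃⟨ ℚᵘP.+-cong (toℚᵘ-toℚ a) (toℚᵘ-toℚ b) ⟨
    toℚᵘ (toℚ a) ℚᵘ.+ toℚᵘ (toℚ b)      ≃⟨ ℚP.toℚᵘ-homo-+ (toℚ a) (toℚ b) ⟨
    toℚᵘ (toℚ a + toℚ b)                ∎)
    where open ℚᵘP.≤-Reasoning

  toℚ-neg : ∀ a → toℚ (ℤ.- a) ≡ - toℚ a
  toℚ-neg a = ℚP.toℚᵘ-injective (begin-equality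
    toℚᵘ (toℚ (ℤ.- a))      ≃⟨ toℚᵘ-toℚ (ℤ.- a) ⟩
    mkℚᵘ (ℤ.- a) 0          ≃⟨ ℚᵘP.-‿cong (toℚᵘ-toℚ a) ⟨
    ℚᵘ.- toℚᵘ (toℚ a)       ≃⟨ ℚP.toℚᵘ-homo‿- (toℚ a) ⟨
    toℚᵘ (- toℚ a)          ∎)
    where open ℚᵘP.≤-Reasoning

  toℚ-sum : ∀ {n} (f : Fin n → ℤ) → toℚ (sumℤ f) ≡ sumℚ (toℚ ∘ f)
  toℚ-sum {zero}  f = refl
  toℚ-sum {suc n} f = trans (toℚ-+ (f zero) (sumℤ (f ∘ suc))) (cong (λ w → toℚ (f zero) + w) (toℚ-sum (f ∘ suc)))

  toℚ≡0⇒≡0 : ∀ z → toℚ z ≡ 0ℚ → z ≡ 0ℤ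
  toℚ≡0⇒≡0 z toℚz≡0 with *≡* eq ← ℚᵘP.≃-trans (ℚᵘP.≃-sym (toℚᵘ-toℚ z)) (ℚP.toℚᵘ-cong toℚz≡0) =
    trans (sym (ℤP.*-identityʳ z)) eq

module SignCount where

  open ≡-Reasoning

  sumℤ-signs : ∀ {n} (f : Fin n → ℤ) → (∀ i → f i ≡ 1ℤ ⊎ f i ≡ -1ℤ) →
               sumℤ f ≡ ℤ.+ countEq f 1ℤ ℤ.- ℤ.+ countEq f -1ℤ
  sumℤ-signs {zero}  f _  = refl
  sumℤ-signs {suc n} f ±1 with f zero ℤ.≟ 1ℤ | f zero ℤ.≟ -1ℤ | ±1 zero
  ... | yes _ | yes f₀≡-1 | inj₁ f₀≡1  = contradiction (trans (sym f₀≡1) f₀≡-1) (λ ())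
  ... | yes _ | no _      | inj₁ f₀≡1 rewrite f₀≡1 = begin
    1ℤ ℤ.+ sumℤ (f ∘ suc)         ≡⟨ cong (λ w → 1ℤ ℤ.+ w) (sumℤ-signs (f ∘ suc) (±1 ∘ suc)) ⟩
    1ℤ ℤ.+ (ℤ.+ p ℤ.- ℤ.+ q)      ≡⟨ ℤP.+-assoc 1ℤ (ℤ.+ p) (ℤ.- ℤ.+ q) ⟨
    ℤ.+ suc p ℤ.- ℤ.+ q           ∎
    where p = countEq (f ∘ suc) 1ℤ; q = countEq (f ∘ suc) -1ℤ
  ... | no f₀≢1 | _        | inj₁ f₀≡1  = contradiction f₀≡1 f₀≢1
  ... | _       | no f₀≢-1 | inj₂ f₀≡-1 = contradiction f₀≡-1 f₀≢-1
  ... | yes f₀≡1 | yes _   | inj₂ f₀≡-1 = contradiction (trans (sym f₀≡1) f₀≡-1) (λ ())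
  ... | no _    | yes _    | inj₂ f₀≡-1 rewrite f₀≡-1 = begin
    -1ℤ ℤ.+ sumℤ (f ∘ suc)        ≡⟨ cong (λ w → -1ℤ ℤ.+ w) (sumℤ-signs (f ∘ suc) (±1 ∘ suc)) ⟩
    -1ℤ ℤ.+ (ℤ.+ p ℤ.- ℤ.+ q)     ≡⟨ ℤP.+-comm -1ℤ (ℤ.+ p ℤ.- ℤ.+ q) ⟩
    (ℤ.+ p ℤ.- ℤ.+ q) ℤ.+ -1ℤ     ≡⟨ ℤP.+-assoc (ℤ.+ p) (ℤ.- ℤ.+ q) -1ℤ ⟩
    ℤ.+ p ℤ.+ (ℤ.- ℤ.+ q ℤ.- 1ℤ)  ≡⟨ cong (λ w → ℤ.+ p ℤ.+ w) (ℤP.neg-distrib-+ (ℤ.+ q) 1ℤ) ⟨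
    ℤ.+ p ℤ.- (ℤ.+ q ℤ.+ 1ℤ)      ≡⟨ cong (λ w → ℤ.+ p ℤ.- w) (ℤP.+-comm (ℤ.+ q) 1ℤ) ⟩
    ℤ.+ p ℤ.- ℤ.+ suc q           ∎
    where p = countEq (f ∘ suc) 1ℤ; q = countEq (f ∘ suc) -1ℤ

module Sums where

  open import Algebra.Properties.Semiring.Sum (Ring.semiring ℚP.+-*-ring)

  sumℚ≡sum : ∀ {n} (f : Fin n → ℚ) → sumℚ f ≡ sum f
  sumℚ≡sum {zero}  f = refl
  sumℚ≡sum {suc n} f = cong (f zero +_) (sumℚ≡sum (f ∘ suc))

  sumℚ-cong : ∀ {n} {f g : Fin n → ℚ} → (∀ i → f i ≡ g i) → sumℚ f ≡ sumℚ g
  sumℚ-cong {f = f} {g} f≗g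
    rewrite sumℚ≡sum f | sumℚ≡sum g = sum-cong-≗ f≗g

  sumℚ-zero : ∀ {n} {f : Fin n → ℚ} → (∀ i → f i ≡ 0ℚ) → sumℚ f ≡ 0ℚ
  sumℚ-zero {n} f≗0 = trans (sumℚ-cong f≗0) (trans (sumℚ≡sum {n} (λ _ → 0ℚ)) (sum-replicate-zero n))

  sumℚ-distrib-+ : ∀ {n} (f g : Fin n → ℚ) → sumℚ (λ i → f i + g i) ≡ sumℚ f + sumℚ g
  sumℚ-distrib-+ f g
    rewrite sumℚ≡sum (λ i → f i + g i) | sumℚ≡sum f | sumℚ≡sum g = ∑-distrib-+ f g

  *-distribˡ-sumℚ : ∀ {n} (c : ℚ) (f : Fin n → ℚ) → c * sumℚ f ≡ sumℚ (λ i → c * f i)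
  *-distribˡ-sumℚ c f
    rewrite sumℚ≡sum f | sumℚ≡sum (λ i → c * f i) = *-distribˡ-sum c f

  *-distribʳ-sumℚ : ∀ {n} (c : ℚ) (f : Fin n → ℚ) → sumℚ f * c ≡ sumℚ (λ i → f i * c)
  *-distribʳ-sumℚ c f
    rewrite sumℚ≡sum f | sumℚ≡sum (λ i → f i * c) = *-distribʳ-sum c f

  private
    neg-as-* : ∀ x → - x ≡ - 1ℚ * x
    neg-as-* x = trans (cong -_ (sym (ℚP.*-identityˡ x))) (ℚP.neg-distribˡ-* 1ℚ x)

  sumℚ-neg : ∀ {n} (f : Fin n → ℚ) → sumℚ (λ i → - f i) ≡ - sumℚ f
  sumℚ-neg f = begin
    sumℚ (λ i → - f i)         ≡⟨ sumℚ-cong (λ i → neg-as-* (f i)) ⟩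
    sumℚ (λ i → - 1ℚ * f i)    ≡⟨ *-distribˡ-sumℚ (- 1ℚ) f ⟨
    - 1ℚ * sumℚ f              ≡⟨ neg-as-* (sumℚ f) ⟨
    - sumℚ f                   ∎
    where open ≡-Reasoning

  sumℚ-distrib-sub : ∀ {n} (f g : Fin n → ℚ) → sumℚ (λ i → f i - g i) ≡ sumℚ f - sumℚ g
  sumℚ-distrib-sub f g = trans (sumℚ-distrib-+ f (λ i → - g i)) (cong (sumℚ f +_) (sumℚ-neg g))

  sumℚ-comm : ∀ {m n} (f : Fin m → Fin n → ℚ) →
              sumℚ (λ i → sumℚ (f i)) ≡ sumℚ (λ j → sumℚ (λ i → f i j))
  sumℚ-comm f
    rewrite sumℚ≡sum (λ i → sumℚ (f i)) | sumℚ≡sum (λ j → sumℚ (λ i → f i j))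
          | sum-cong-≗ (λ i → sumℚ≡sum (f i)) | sum-cong-≗ (λ j → sumℚ≡sum (λ i → f i j))
    = ∑-comm f

  sumℚ-punchIn : ∀ {n} (a : Fin (suc n)) (f : Fin (suc n) → ℚ) →
                 sumℚ f ≡ f a + sumℚ (f ∘ punchIn a)
  sumℚ-punchIn a f rewrite sumℚ≡sum f | sumℚ≡sum (f ∘ punchIn a) = sum-remove f

  sumℚ-single : ∀ {n} (a : Fin n) (f : Fin n → ℚ) → (∀ i → i ≢ a → f i ≡ 0ℚ) → sumℚ f ≡ f a
  sumℚ-single {suc n} a f f≡0 = begin
    sumℚ f                      ≡⟨ sumℚ-punchIn a f ⟩
    f a + sumℚ (f ∘ punchIn a)  ≡⟨ cong (f a +_) (sumℚ-zero (λ i → f≡0 (punchIn a i) (punchInᵢ≢i a i))) ⟩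
    f a + 0ℚ                    ≡⟨ ℚP.+-identityʳ (f a) ⟩
    f a                         ∎
    where open ≡-Reasoning

  sumℚ-pair : ∀ {n} (a b : Fin n) (f : Fin n → ℚ) → a ≢ b →
              (∀ i → i ≢ a → i ≢ b → f i ≡ 0ℚ) → sumℚ f ≡ f a + f b
  sumℚ-pair {suc n} a b f a≢b f≡0 = begin
    sumℚ f                      ≡⟨ sumℚ-punchIn a f ⟩
    f a + sumℚ (f ∘ punchIn a)  ≡⟨ cong (f a +_) (sumℚ-single (punchOut a≢b) (f ∘ punchIn a) off-b) ⟩
    f a + f (punchIn a (punchOut a≢b)) ≡⟨ cong (λ i → f a + f i) (punchIn-punchOut a≢b) ⟩
    f a + f b                   ∎
    where
    open ≡-Reasoning
    off-b : ∀ i → i ≢ punchOut a≢b → f (punchIn a i) ≡ 0ℚ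
    off-b i i≢ = f≡0 (punchIn a i) (punchInᵢ≢i a i)
                     (λ eq → i≢ (trans (sym (punchOut-punchIn a)) (punchOut-cong a eq)))

  partialSum : ∀ {k} → (Fin k → ℚ) → Fin (suc k) → ℚ
  partialSum         f zero    = 0ℚ
  partialSum {suc k} f (suc i) = f zero + partialSum (f ∘ suc) i

  partialSum-suc : ∀ {k} (f : Fin k → ℚ) i → partialSum f (suc i) ≡ partialSum f (inject₁ i) + f i
  partialSum-suc {suc k} f zero    = trans (ℚP.+-identityʳ (f zero)) (sym (ℚP.+-identityˡ (f zero)))
  partialSum-suc {suc k} f (suc i) = trans (cong (f zero +_) (partialSum-suc (f ∘ suc) i))
                                           (sym (ℚP.+-assoc (f zero) (partialSum (f ∘ suc) (inject₁ i)) (f (suc i))))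

  partialSum-last : ∀ {k} (f : Fin k → ℚ) → partialSum f (fromℕ k) ≡ sumℚ f
  partialSum-last {zero}  f = refl
  partialSum-last {suc k} f = cong (f zero +_) (partialSum-last (f ∘ suc))

  sumℚ-init-last : ∀ {m} (f : Fin (suc m) → ℚ) →
                   sumℚ f ≡ sumℚ (f ∘ inject₁) + f (fromℕ m)
  sumℚ-init-last f rewrite sumℚ≡sum f | sumℚ≡sum (f ∘ inject₁) = sum-init-last f

module Dimension where

  open RationalFacts
  open Sums
  open import Data.Nat.Properties using (≤-antisym; ≰⇒>; m<n⇒m<1+n)
  open import Data.Vec.Functional using (_∷_)
  open import Relation.Nullary.Decidable using (decidable-stable; ¬?)
  open ≡-Reasoning

  -- HasNullity M k unfolds to Basis (InKernel M) k.
  Basis : ∀ {n} → (Vecℚ n → Set) → ℕ → Set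
  Basis {n} K k = Σ (Fin k → Vecℚ n) λ b →
    (∀ t → K (b t)) ×
    (∀ (c : Fin k → ℚ) → (∀ j → lincomb c b j ≡ 0ℚ) → ∀ t → c t ≡ 0ℚ) ×
    (∀ x → K x → Σ (Fin k → ℚ) λ c → ∀ j → x j ≡ lincomb c b j)

  record RowDependence {p q} (M : Fin p → Fin q → ℚ) : Set where
    field
      coeff    : Fin p → ℚ
      nonzero  : ∃ λ i → coeff i ≢ 0ℚ
      relation : ∀ t → sumℚ (λ i → coeff i * M i t) ≡ 0ℚ

  -- one step of Gaussian elimination, with pivot M i₀ zero
  module _ {p q} (M : Fin (suc p) → Fin (suc q) → ℚ) (i₀ : Fin (suc p))
           (pivot≢0 : M i₀ zero ≢ 0ℚ) where

    private instance
      pivot-nonZero : ℚ.NonZero (M i₀ zero)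
      pivot-nonZero = ℚ.≢-nonZero pivot≢0

    ratio : Fin p → ℚ
    ratio i = M (punchIn i₀ i) zero * 1/ M i₀ zero

    eliminate : Fin p → Fin (suc q) → ℚ
    eliminate i t = M (punchIn i₀ i) t - ratio i * M i₀ t

    eliminate-pivot-column : ∀ i → eliminate i zero ≡ 0ℚ
    eliminate-pivot-column i = begin
      a - a * 1/ π * π    ≡⟨ cong (λ w → a - w) (trans (ℚP.*-assoc a (1/ π) π) (cong (a *_) (ℚP.*-inverseˡ π))) ⟩
      a - a * 1ℚ          ≡⟨ cong (λ w → a - w) (ℚP.*-identityʳ a) ⟩
      a - a               ≡⟨ ℚP.+-inverseʳ a ⟩
      0ℚ                  ∎
      where a = M (punchIn i₀ i) zero; π = M i₀ zero

    lift-dependence : RowDependence (λ i t → eliminate i (suc t)) → RowDependence M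
    lift-dependence dep = record
      { coeff    = c
      ; nonzero  = punchIn i₀ j , λ cⱼ≡0 → c'ⱼ≢0 (trans (sym (insertAt-punchIn c' i₀ c₀ j)) cⱼ≡0)
      ; relation = λ t → trans (combination t) (relation′ t)
      }
      where
      open RowDependence dep renaming (coeff to c'; nonzero to nonzero'; relation to relation')
      j : Fin p
      j = proj₁ nonzero'
      c'ⱼ≢0 : c' j ≢ 0ℚ
      c'ⱼ≢0 = proj₂ nonzero'
      c₀ : ℚ
      c₀ = - sumℚ (λ i → c' i * ratio i)
      c : Fin (suc p) → ℚ
      c = insertAt c' i₀ c₀

      combination : ∀ t → sumℚ (λ k → c k * M k t) ≡ sumℚ (λ i → c' i * eliminate i t)
      combination t = begin
        sumℚ (λ k → c k * M k t)
          ≡⟨ sumℚ-punchIn i₀ (λ k → c k * M k t) ⟩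
        c i₀ * M i₀ t + sumℚ (λ i → c (punchIn i₀ i) * M (punchIn i₀ i) t)
          ≡⟨ cong₂ _+_ (cong (_* M i₀ t) (insertAt-lookup c' i₀ c₀))
                       (sumℚ-cong (λ i → cong (_* M (punchIn i₀ i) t) (insertAt-punchIn c' i₀ c₀ i))) ⟩
        - S * μ + T
          ≡⟨ solve 3 (λ S m T → :- S :* m :+ T := T :- S :* m) refl S μ T ⟩
        T - S * μ
          ≡⟨ cong (λ w → T - w) (*-distribʳ-sumℚ μ (λ i → c' i * ratio i)) ⟩
        T - sumℚ (λ i → c' i * ratio i * μ)
          ≡⟨ sym (sumℚ-distrib-sub (λ i → c' i * M (punchIn i₀ i) t) (λ i → c' i * ratio i * μ)) ⟩
        sumℚ (λ i → c' i * M (punchIn i₀ i) t - c' i * ratio i * μ)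
          ≡⟨ sumℚ-cong (λ i → solve 4 (λ c a r m → c :* a :- c :* r :* m := c :* (a :- r :* m))
                                      refl (c' i) (M (punchIn i₀ i) t) (ratio i) μ) ⟩
        sumℚ (λ i → c' i * eliminate i t) ∎
        where
        S T μ : ℚ
        S = sumℚ (λ i → c' i * ratio i)
        T = sumℚ (λ i → c' i * M (punchIn i₀ i) t)
        μ = M i₀ t

      relation′ : ∀ t → sumℚ (λ i → c' i * eliminate i t) ≡ 0ℚ
      relation′ zero    = sumℚ-zero (λ i → trans (cong (c' i *_) (eliminate-pivot-column i)) (ℚP.*-zeroʳ (c' i)))
      relation′ (suc t) = relation' t

  rows-dependent : ∀ {p q} → q ℕ.< p → (M : Fin p → Fin q → ℚ) → RowDependence M
  rows-dependent {suc p} {zero} _ M = record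
    { coeff = λ _ → 1ℚ ; nonzero = zero , (λ ()) ; relation = λ () }
  rows-dependent {suc p} {suc q} (ℕ.s≤s q<p) M
    with any? (λ i → ¬? (M i zero ℚ.≟ 0ℚ))
  ... | yes (i₀ , pivot≢0) = lift-dependence M i₀ pivot≢0 (rows-dependent q<p _)
  ... | no no-pivot = record
    { coeff = coeff ; nonzero = nonzero ; relation = λ { zero → first-column ; (suc t) → relation t } }
    where
    open RowDependence (rows-dependent (m<n⇒m<1+n q<p) (λ i t → M i (suc t)))
    first-column : sumℚ (λ i → coeff i * M i zero) ≡ 0ℚ
    first-column = sumℚ-zero λ i →
      trans (cong (coeff i *_) (decidable-stable (M i zero ℚ.≟ 0ℚ) (λ ≢0 → no-pivot (i , ≢0))))
            (ℚP.*-zeroʳ (coeff i))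

  basis-size-≤ : ∀ {n} {K : Vecℚ n → Set} {k k'} → Basis K k → Basis K k' → k' ℕ.≤ k
  basis-size-≤ {k = k} {k'} (b , _ , _ , b-span) (b' , b'∈K , b'-indep , _) with k' ℕ.≤? k
  ... | yes k'≤k = k'≤k
  ... | no k'≰k = contradiction (b'-indep coeff combination-vanishes (proj₁ nonzero)) (proj₂ nonzero)
    where
    coords : Fin k' → Fin k → ℚ
    coords t = proj₁ (b-span (b' t) (b'∈K t))
    open RowDependence (rows-dependent (≰⇒> k'≰k) coords)
    combination-vanishes : ∀ j → lincomb coeff b' j ≡ 0ℚ
    combination-vanishes j = begin
      sumℚ (λ t → coeff t * b' t j)
        ≡⟨ sumℚ-cong (λ t → cong (coeff t *_) (proj₂ (b-span (b' t) (b'∈K t)) j)) ⟩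
      sumℚ (λ t → coeff t * sumℚ (λ i → coords t i * b i j))
        ≡⟨ sumℚ-cong (λ t → trans (*-distribˡ-sumℚ (coeff t) (λ i → coords t i * b i j))
                                  (sumℚ-cong (λ i → sym (ℚP.*-assoc (coeff t) (coords t i) (b i j))))) ⟩
      sumℚ (λ t → sumℚ (λ i → coeff t * coords t i * b i j))
        ≡⟨ sumℚ-comm (λ t i → coeff t * coords t i * b i j) ⟩
      sumℚ (λ i → sumℚ (λ t → coeff t * coords t i * b i j))
        ≡⟨ sumℚ-cong (λ i → sym (*-distribʳ-sumℚ (b i j) (λ t → coeff t * coords t i))) ⟩
      sumℚ (λ i → sumℚ (λ t → coeff t * coords t i) * b i j)
        ≡⟨ sumℚ-zero (λ i → trans (cong (_* b i j) (relation i)) (ℚP.*-zeroˡ (b i j))) ⟩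
      0ℚ ∎

  basis-size-unique : ∀ {n} {K : Vecℚ n → Set} {k k'} → Basis K k → Basis K k' → k ≡ k'
  basis-size-unique B B' = ≤-antisym (basis-size-≤ B' B) (basis-size-≤ B B')

  constant-basis : ∀ {n} {K : Vecℚ n → Set} (u : Fin n) →
                   K (λ _ → 1ℚ) → (∀ x → K x → ∀ j → x j ≡ x u) → Basis K 1
  constant-basis {K = K} u K1 constant = (λ _ _ → 1ℚ) , (λ _ → K1) , independent , spanning
    where
    lincomb-ones : ∀ c j → lincomb c (λ _ _ → 1ℚ) j ≡ c zero
    lincomb-ones c j = trans (ℚP.+-identityʳ _) (ℚP.*-identityʳ (c zero))
    independent : ∀ c → (∀ j → lincomb c (λ _ _ → 1ℚ) j ≡ 0ℚ) → ∀ t → c t ≡ 0ℚ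
    independent c vanishes zero = trans (sym (lincomb-ones c u)) (vanishes u)
    spanning : ∀ x → K x → Σ (Fin 1 → ℚ) λ c → ∀ j → x j ≡ lincomb c (λ _ _ → 1ℚ) j
    spanning x Kx = (λ _ → x u) , λ j → trans (constant x Kx j) (sym (lincomb-ones (λ _ → x u) j))

  module Hyperplane {n} {K H : Vecℚ n → Set} (u v : Fin n)
    (H⇒K : ∀ {x} → H x → K x) (H⇒eq : ∀ {x} → H x → x u ≡ x v)
    (eq⇒H : ∀ {x} → K x → x u ≡ x v → H x)
    (K-closed : ∀ {x y} α → K x → K y → K (λ j → x j - α * y j))
    {z : Vecℚ n} (Kz : K z) (z-separates : z u ≢ z v) where

    private
      δ : ℚ
      δ = z u - z v

      δ≢0 : δ ≢ 0ℚ
      δ≢0 = z-separates ∘ p-q≡0⇒p≡q (z u) (z v)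

    extend-basis : ∀ {k} → Basis H k → Basis K (suc k)
    extend-basis {k} (b , b∈H , b-indep , b-span) = z ∷ b , ∈K , independent , spanning
      where
      ∈K : ∀ t → K ((z ∷ b) t)
      ∈K zero    = Kz
      ∈K (suc t) = H⇒K (b∈H t)

      independent : ∀ c → (∀ j → lincomb c (z ∷ b) j ≡ 0ℚ) → ∀ t → c t ≡ 0ℚ
      independent c vanishes = λ { zero → c₀≡0 ; (suc t) → b-indep (c ∘ suc) rest-vanishes t }
        where
        S : Vecℚ n
        S = lincomb (c ∘ suc) b
        Su≡Sv : S u ≡ S v
        Su≡Sv = sumℚ-cong (λ t → cong (c (suc t) *_) (H⇒eq (b∈H t)))
        c₀≡0 : c zero ≡ 0ℚ
        c₀≡0 = p≢0∧p*q≡0⇒q≡0 δ≢0 (begin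
          δ * c zero
            ≡⟨ solve 4 (λ a b c s → (a :- b) :* c := (c :* a :+ s) :- (c :* b :+ s)) refl (z u) (z v) (c zero) (S v) ⟩
          (c zero * z u + S v) - (c zero * z v + S v)
            ≡⟨ cong (λ w → (c zero * z u + w) - (c zero * z v + S v)) (sym Su≡Sv) ⟩
          (c zero * z u + S u) - (c zero * z v + S v)
            ≡⟨ cong₂ _-_ (vanishes u) (vanishes v) ⟩
          0ℚ ∎)
        rest-vanishes : ∀ j → S j ≡ 0ℚ
        rest-vanishes j = begin
          S j                    ≡⟨ sym (ℚP.+-identityˡ (S j)) ⟩
          0ℚ + S j               ≡⟨ cong (_+ S j) (sym (trans (cong (_* z j) c₀≡0) (ℚP.*-zeroˡ (z j)))) ⟩
          c zero * z j + S j     ≡⟨ vanishes j ⟩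
          0ℚ                     ∎

      spanning : ∀ x → K x → Σ (Fin (suc k) → ℚ) λ c → ∀ j → x j ≡ lincomb c (z ∷ b) j
      spanning x Kx = α ∷ d , λ j → begin
        x j                        ≡⟨ solve 3 (λ x a z → x := a :* z :+ (x :- a :* z)) refl (x j) α (z j) ⟩
        α * z j + y j              ≡⟨ cong (α * z j +_) (proj₂ (b-span y Hy) j) ⟩
        α * z j + lincomb d b j    ∎
        where
        instance
          δ-nonZero : ℚ.NonZero δ
          δ-nonZero = ℚ.≢-nonZero δ≢0
        α : ℚ
        α = (x u - x v) * 1/ δ
        y : Vecℚ n
        y j = x j - α * z j
        Hy : H y
        Hy = eq⇒H (K-closed α Kx Kz) (p-q≡0⇒p≡q (y u) (y v) (begin
          (x u - α * z u) - (x v - α * z v)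
            ≡⟨ solve 5 (λ a b c d al → (a :- al :* c) :- (b :- al :* d) := (a :- b) :- al :* (c :- d))
                       refl (x u) (x v) (z u) (z v) α ⟩
          (x u - x v) - α * δ
            ≡⟨ cong (λ w → (x u - x v) - w) (trans (ℚP.*-assoc (x u - x v) (1/ δ) δ)
                 (trans (cong ((x u - x v) *_) (ℚP.*-inverseˡ δ)) (ℚP.*-identityʳ (x u - x v)))) ⟩
          (x u - x v) - (x u - x v)
            ≡⟨ ℚP.+-inverseʳ (x u - x v) ⟩
          0ℚ ∎))
        d : Fin k → ℚ
        d = proj₁ (b-span y Hy)

module NetLaplacian {n : ℕ} where

  open RationalFacts
  open Sums
  open import Data.Bool using (Bool; true; false; if_then_else_; _∧_; not)
  open import Relation.Nullary.Decidable using (⌊_⌋)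
  open import Relation.Unary using (Decidable)
  open ≡-Reasoning

  Symmetric : Mat n → Set
  Symmetric B = ∀ i j → B i j ≡ B j i

  Ker : Mat n → Vecℚ n → Set
  Ker B = InKernel (netLaplacian B)

  flow : Mat n → Vecℚ n → Fin n → Fin n → ℚ
  flow B x i k = toℚ (B i k) * (x i - x k)

  netLaplacian-apply : ∀ B x i → mulVec (netLaplacian B) x i ≡ sumℚ (flow B x i)
  netLaplacian-apply B x i = begin
    sumℚ (λ j → toℚ (δ j ℤ.- B i j) * x j)
      ≡⟨ sumℚ-cong (λ j → cong (_* x j) (trans (toℚ-+ (δ j) (ℤ.- B i j))
                                              (cong (toℚ (δ j) +_) (toℚ-neg (B i j))))) ⟩
    sumℚ (λ j → (toℚ (δ j) - b j) * x j)
      ≡⟨ sumℚ-cong (λ j → solve 3 (λ d b x → (d :- b) :* x := d :* x :- b :* x) refl (toℚ (δ j)) (b j) (x j)) ⟩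
    sumℚ (λ j → toℚ (δ j) * x j - b j * x j)
      ≡⟨ sumℚ-distrib-sub (λ j → toℚ (δ j) * x j) (λ j → b j * x j) ⟩
    sumℚ (λ j → toℚ (δ j) * x j) - sumℚ (λ j → b j * x j)
      ≡⟨ cong (_- sumℚ (λ j → b j * x j)) (sumℚ-single i (λ j → toℚ (δ j) * x j) off-diagonal) ⟩
    toℚ (δ i) * x i - sumℚ (λ j → b j * x j)
      ≡⟨ cong (λ d → d * x i - sumℚ (λ j → b j * x j)) (trans (cong toℚ diagonal) (toℚ-sum (B i))) ⟩
    sumℚ b * x i - sumℚ (λ j → b j * x j)
      ≡⟨ cong (_- sumℚ (λ j → b j * x j)) (*-distribʳ-sumℚ (x i) b) ⟩
    sumℚ (λ k → b k * x i) - sumℚ (λ j → b j * x j)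
      ≡⟨ sym (sumℚ-distrib-sub (λ k → b k * x i) (λ j → b j * x j)) ⟩
    sumℚ (λ k → b k * x i - b k * x k)
      ≡⟨ sumℚ-cong (λ k → solve 3 (λ b u v → b :* u :- b :* v := b :* (u :- v)) refl (b k) (x i) (x k)) ⟩
    sumℚ (flow B x i) ∎
    where
    b : Fin n → ℚ
    b k = toℚ (B i k)
    δ : Fin n → ℤ
    δ j = if ⌊ i F.≟ j ⌋ then netDeg B i else 0ℤ
    diagonal : δ i ≡ netDeg B i
    diagonal with i F.≟ i
    ... | yes _   = refl
    ... | no i≢i = contradiction refl i≢i
    off-diagonal : ∀ j → j ≢ i → toℚ (δ j) * x j ≡ 0ℚ
    off-diagonal j j≢i with i F.≟ j
    ... | yes i≡j = contradiction (sym i≡j) j≢i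
    ... | no _    = ℚP.*-zeroˡ (x j)

  Ker-cong : ∀ {B B' x} → (∀ i k → flow B x i k ≡ flow B' x i k) → Ker B x → Ker B' x
  Ker-cong {B} {B'} {x} same Bx i = begin
    mulVec (netLaplacian B') x i ≡⟨ netLaplacian-apply B' x i ⟩
    sumℚ (flow B' x i)           ≡⟨ sumℚ-cong (λ k → sym (same i k)) ⟩
    sumℚ (flow B x i)            ≡⟨ netLaplacian-apply B x i ⟨
    mulVec (netLaplacian B) x i  ≡⟨ Bx i ⟩
    0ℚ                           ∎

  Ker-ones : ∀ B → Ker B (λ _ → 1ℚ)
  Ker-ones B i = trans (netLaplacian-apply B (λ _ → 1ℚ) i)
    (sumℚ-zero (λ k → trans (cong (toℚ (B i k) *_) (ℚP.+-inverseʳ 1ℚ)) (ℚP.*-zeroʳ (toℚ (B i k)))))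

  Ker-sub-* : ∀ B {x y} α → Ker B x → Ker B y → Ker B (λ j → x j - α * y j)
  Ker-sub-* B {x} {y} α Bx By i = begin
    sumℚ (λ j → l j * (x j - α * y j))
      ≡⟨ sumℚ-cong (λ j → solve 4 (λ l a b c → l :* (a :- c :* b) := l :* a :- c :* (l :* b))
                                  refl (l j) (x j) (y j) α) ⟩
    sumℚ (λ j → l j * x j - α * (l j * y j))
      ≡⟨ sumℚ-distrib-sub (λ j → l j * x j) (λ j → α * (l j * y j)) ⟩
    mulVec (netLaplacian B) x i - sumℚ (λ j → α * (l j * y j))
      ≡⟨ cong₂ _-_ (Bx i) (sym (*-distribˡ-sumℚ α (λ j → l j * y j))) ⟩
    0ℚ - α * mulVec (netLaplacian B) y i
      ≡⟨ cong (λ w → 0ℚ - α * w) (By i) ⟩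
    0ℚ - α * 0ℚ
      ≡⟨ cong (λ w → 0ℚ - w) (ℚP.*-zeroʳ α) ⟩
    0ℚ ∎
    where
    l : Fin n → ℚ
    l j = toℚ (netLaplacian B i j)

  flow-no-edge : ∀ B x {i k} → B i k ≡ 0ℤ → flow B x i k ≡ 0ℚ
  flow-no-edge B x {i} {k} Bik≡0 = trans (cong (λ b → toℚ b * (x i - x k)) Bik≡0) (ℚP.*-zeroˡ (x i - x k))

  flow-flat : ∀ B x {i k} → x i ≡ x k → flow B x i k ≡ 0ℚ
  flow-flat B x {i} {k} xi≡xk = trans (cong (toℚ (B i k) *_) (p≡q⇒p-q≡0 xi≡xk)) (ℚP.*-zeroʳ (toℚ (B i k)))

  flow-antisym : ∀ {B} → Symmetric B → ∀ x i k → flow B x k i ≡ - flow B x i k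
  flow-antisym {B} B-sym x i k = begin
    toℚ (B k i) * (x k - x i) ≡⟨ cong (λ b → toℚ b * (x k - x i)) (B-sym k i) ⟩
    toℚ (B i k) * (x k - x i) ≡⟨ solve 3 (λ b u v → b :* (v :- u) := :- (b :* (u :- v)))
                                         refl (toℚ (B i k)) (x i) (x k) ⟩
    - flow B x i k            ∎

  module Cut {B : Mat n} (B-sym : Symmetric B) {x : Vecℚ n} (Bx : Ker B x)
             {S : Fin n → Set} (S? : Decidable S) where

    private
      T : Fin n → Bool
      T i = ⌊ S? i ⌋

      inside outward : Fin n → Fin n → ℚ
      inside  i k = if T i ∧ T k       then flow B x i k else 0ℚ
      outward i k = if T i ∧ not (T k) then flow B x i k else 0ℚ

      inside-vanishes : sumℚ (λ i → sumℚ (inside i)) ≡ 0ℚ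
      inside-vanishes = p≡-p⇒p≡0 _ (begin
        sumℚ (λ i → sumℚ (inside i))          ≡⟨ sumℚ-comm inside ⟩
        sumℚ (λ k → sumℚ (λ i → inside i k))  ≡⟨ sumℚ-cong (λ k → sumℚ-cong (λ i → antisym k i)) ⟩
        sumℚ (λ k → sumℚ (λ i → - inside k i)) ≡⟨ sumℚ-cong (λ k → sumℚ-neg (inside k)) ⟩
        sumℚ (λ k → - sumℚ (inside k))        ≡⟨ sumℚ-neg (λ k → sumℚ (inside k)) ⟩
        - sumℚ (λ k → sumℚ (inside k))        ∎)
        where
        antisym : ∀ k i → inside i k ≡ - inside k i
        antisym k i with T i | T k
        ... | true  | true  = flow-antisym B-sym x k i
        ... | true  | false = refl
        ... | false | true  = refl
        ... | false | false = refl

      split : ∀ i k → (if T i then flow B x i k else 0ℚ) ≡ inside i k + outward i k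
      split i k with T i | T k
      ... | true  | true  = sym (ℚP.+-identityʳ _)
      ... | true  | false = sym (ℚP.+-identityˡ _)
      ... | false | _     = refl

      restricted-rows : ∀ i → sumℚ (λ k → if T i then flow B x i k else 0ℚ) ≡ 0ℚ
      restricted-rows i with T i
      ... | true  = trans (sym (netLaplacian-apply B x i)) (Bx i)
      ... | false = sumℚ-zero {n} (λ _ → refl)

      flow-across-cut : sumℚ (λ i → sumℚ (outward i)) ≡ 0ℚ
      flow-across-cut = begin
        O            ≡⟨ solve 2 (λ I O → O := I :+ O :- I) refl I O ⟩
        I + O - I    ≡⟨ cong₂ _-_ rows-split (sym inside-vanishes) ⟨
        rows - 0ℚ    ≡⟨ cong (_- 0ℚ) (sumℚ-zero restricted-rows) ⟩
        0ℚ           ∎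
        where
        I O rows : ℚ
        I = sumℚ (λ i → sumℚ (inside i))
        O = sumℚ (λ i → sumℚ (outward i))
        rows = sumℚ (λ i → sumℚ (λ k → if T i then flow B x i k else 0ℚ))
        rows-split : rows ≡ I + O
        rows-split = trans (sumℚ-cong (λ i → trans (sumℚ-cong (split i)) (sumℚ-distrib-+ (inside i) (outward i))))
                           (sumℚ-distrib-+ (λ i → sumℚ (inside i)) (λ i → sumℚ (outward i)))

    flow-out-of-cut : ∀ w → S w → (∀ i k → S i → ¬ S k → B i k ≢ 0ℤ → i ≡ w) →
                      sumℚ (λ k → if T k then 0ℚ else flow B x w k) ≡ 0ℚ
    flow-out-of-cut w Sw single-exit = begin
      sumℚ (λ k → if T k then 0ℚ else flow B x w k)  ≡⟨ sumℚ-cong row-w ⟨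
      sumℚ (outward w)                               ≡⟨ sumℚ-single w (λ i → sumℚ (outward i)) other-rows ⟨
      sumℚ (λ i → sumℚ (outward i))                  ≡⟨ flow-across-cut ⟩
      0ℚ                                             ∎
      where
      row-w : ∀ k → outward w k ≡ (if T k then 0ℚ else flow B x w k)
      row-w k with S? w | S? k
      ... | yes _  | yes _ = refl
      ... | yes _  | no _  = refl
      ... | no ¬Sw | _     = contradiction Sw ¬Sw
      other-rows : ∀ i → i ≢ w → sumℚ (outward i) ≡ 0ℚ
      other-rows i i≢w = sumℚ-zero λ k → vanish k
        where
        vanish : ∀ k → outward i k ≡ 0ℚ
        vanish k with S? i | S? k
        ... | no _   | _      = refl
        ... | yes _  | yes _  = refl
        ... | yes Si | no ¬Sk with B i k ℤ.≟ 0ℤ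
        ...   | yes Bik≡0 = flow-no-edge B x Bik≡0
        ...   | no Bik≢0  = contradiction (single-exit i k Si ¬Sk Bik≢0) i≢w

module EdgeDeletion {n} (A : Mat n) (u v : Fin n) where

  open NetLaplacian
  open import Data.Bool using (_∧_; _∨_)
  open import Relation.Nullary.Decidable using (⌊_⌋; isYes≗does; dec-true; dec-false; _×-dec_; _⊎-dec_; does)

  IsEdge : Fin n → Fin n → Set
  IsEdge i j = (i ≡ u × j ≡ v) ⊎ (i ≡ v × j ≡ u)

  IsEdge-sym : ∀ {i j} → IsEdge i j → IsEdge j i
  IsEdge-sym (inj₁ (i≡u , j≡v)) = inj₂ (j≡v , i≡u)
  IsEdge-sym (inj₂ (i≡v , j≡u)) = inj₁ (j≡u , i≡v)

  IsEdge-unique : ∀ {i j i' j'} → IsEdge i j → IsEdge i' j' → (i ≡ i' × j ≡ j') ⊎ (i ≡ j' × j ≡ i')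
  IsEdge-unique (inj₁ (refl , refl)) (inj₁ (refl , refl)) = inj₁ (refl , refl)
  IsEdge-unique (inj₁ (refl , refl)) (inj₂ (refl , refl)) = inj₂ (refl , refl)
  IsEdge-unique (inj₂ (refl , refl)) (inj₁ (refl , refl)) = inj₂ (refl , refl)
  IsEdge-unique (inj₂ (refl , refl)) (inj₂ (refl , refl)) = inj₁ (refl , refl)

  isEdge? : ∀ i j → Dec (IsEdge i j)
  isEdge? i j = ((i F.≟ u) ×-dec (j F.≟ v)) ⊎-dec ((i F.≟ v) ×-dec (j F.≟ u))

  private
    deleteEdge-test : ∀ i j →
      ((⌊ i F.≟ u ⌋ ∧ ⌊ j F.≟ v ⌋) ∨ (⌊ i F.≟ v ⌋ ∧ ⌊ j F.≟ u ⌋)) ≡ does (isEdge? i j)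
    deleteEdge-test i j
      rewrite isYes≗does (i F.≟ u) | isYes≗does (j F.≟ v) | isYes≗does (i F.≟ v) | isYes≗does (j F.≟ u) = refl

  deleteEdge-on : ∀ {i j} → IsEdge i j → deleteEdge A u v i j ≡ 0ℤ
  deleteEdge-on {i} {j} e rewrite deleteEdge-test i j | dec-true (isEdge? i j) e = refl

  deleteEdge-off : ∀ {i j} → ¬ IsEdge i j → deleteEdge A u v i j ≡ A i j
  deleteEdge-off {i} {j} ¬e rewrite deleteEdge-test i j | dec-false (isEdge? i j) ¬e = refl

  deleteEdge-sym : Symmetric A → Symmetric (deleteEdge A u v)
  deleteEdge-sym A-sym i j with isEdge? i j
  ... | yes e = trans (deleteEdge-on e) (sym (deleteEdge-on (IsEdge-sym e)))
  ... | no ¬e = trans (deleteEdge-off ¬e) (trans (A-sym i j) (sym (deleteEdge-off (¬e ∘ IsEdge-sym))))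

  deleteEdge-support : ∀ i j → deleteEdge A u v i j ≢ 0ℤ → A i j ≢ 0ℤ
  deleteEdge-support i j ≢0 with isEdge? i j
  ... | yes e = contradiction (deleteEdge-on e) ≢0
  ... | no ¬e = subst (_≢ 0ℤ) (deleteEdge-off ¬e) ≢0

  flow-deleteEdge : ∀ x → x u ≡ x v → ∀ i k → flow (deleteEdge A u v) x i k ≡ flow A x i k
  flow-deleteEdge x xu≡xv i k with isEdge? i k
  ... | no ¬e = cong (λ b → toℚ b * (x i - x k)) (deleteEdge-off ¬e)
  ... | yes e = trans (cong (toℚ (deleteEdge A u v i k) *_) (no-difference e))
                  (trans (ℚP.*-zeroʳ (toℚ (deleteEdge A u v i k)))
                     (sym (trans (cong (toℚ (A i k) *_) (no-difference e)) (ℚP.*-zeroʳ (toℚ (A i k))))))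
    where
    no-difference : IsEdge i k → x i - x k ≡ 0ℚ
    no-difference (inj₁ (refl , refl)) = RationalFacts.p≡q⇒p-q≡0 xu≡xv
    no-difference (inj₂ (refl , refl)) = RationalFacts.p≡q⇒p-q≡0 (sym xu≡xv)

  Ker⇒Ker-deleteEdge : ∀ {x} → Ker A x → x u ≡ x v → Ker (deleteEdge A u v) x
  Ker⇒Ker-deleteEdge {x} Ax xu≡xv = Ker-cong (λ i k → sym (flow-deleteEdge x xu≡xv i k)) Ax

module CyclicOrder where

  open Sums
  open import Data.Nat.Properties using (≤-pred; <⇒≤; m≢1+n+m)
  open import Data.Fin.Properties using (toℕ-inject₁; toℕ<n; suc-injective)
  open F using (toℕ)

  data LastView : ∀ {m} → Fin (suc m) → Set where
    inner : ∀ {m} (i : Fin m) → LastView (inject₁ i)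
    last  : ∀ {m} → LastView (fromℕ m)

  lastView : ∀ {m} (j : Fin (suc m)) → LastView j
  lastView {zero}  zero    = last
  lastView {suc m} zero    = inner zero
  lastView {suc m} (suc j) with lastView j
  ... | inner i = inner (suc i)
  ... | last    = last

  cnext-inject₁ : ∀ {m} (i : Fin m) → cnext (inject₁ i) ≡ suc i
  cnext-inject₁ {suc m} zero    = refl
  cnext-inject₁ {suc m} (suc i) rewrite cnext-inject₁ i = refl

  cnext-fromℕ : ∀ m → cnext (fromℕ m) ≡ zero
  cnext-fromℕ zero    = refl
  cnext-fromℕ (suc m) rewrite cnext-fromℕ m = refl

  cprev : ∀ {m} → Fin (suc m) → Fin (suc m)
  cprev {m}     zero    = fromℕ m
  cprev {suc m} (suc i) = inject₁ i

  cnext-cprev : ∀ {m} (j : Fin (suc m)) → cnext (cprev j) ≡ j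
  cnext-cprev {m}     zero    = cnext-fromℕ m
  cnext-cprev {suc m} (suc i) = cnext-inject₁ i

  cnext-injective : ∀ {m} (a b : Fin (suc m)) → cnext a ≡ cnext b → a ≡ b
  cnext-injective a b eq with lastView a | lastView b
  ... | inner i | inner j = cong inject₁ (suc-injective (trans (sym (cnext-inject₁ i)) (trans eq (cnext-inject₁ j))))
  ... | inner i | last    with () ← trans (sym (cnext-inject₁ i)) (trans eq (cnext-fromℕ _))
  ... | last    | inner j with () ← trans (sym (cnext-fromℕ _)) (trans eq (cnext-inject₁ j))
  ... | last    | last    = refl

  cprev-cnext : ∀ {m} (j : Fin (suc m)) → cprev (cnext j) ≡ j
  cprev-cnext j = cnext-injective _ _ (cnext-cprev (cnext j))

  cnext≢cprev : ∀ {m} → 2 ℕ.≤ m → (j : Fin (suc m)) → cnext j ≢ cprev j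
  cnext≢cprev {suc (suc m)} _ j with lastView j
  ... | inner zero    = λ ()
  ... | inner (suc i) rewrite cnext-inject₁ (suc i) = λ eq →
    m≢1+n+m (toℕ i) (sym (trans (cong toℕ eq) (trans (toℕ-inject₁ (inject₁ i)) (toℕ-inject₁ i))))
  ... | last          rewrite cnext-fromℕ (suc (suc m)) = λ ()
  cnext≢cprev {suc zero} (ℕ.s≤s ()) _

  -- clamp m k is k as an element of Fin (suc m), saturating at m
  clamp : ∀ m → ℕ → Fin (suc m)
  clamp m       zero    = zero
  clamp zero    (suc k) = zero
  clamp (suc m) (suc k) = suc (clamp m k)

  toℕ-clamp : ∀ {m k} → k ℕ.≤ m → toℕ (clamp m k) ≡ k
  toℕ-clamp {m}     {zero}  _            = refl
  toℕ-clamp {suc m} {suc k} (ℕ.s≤s k≤m) = cong suc (toℕ-clamp k≤m)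

  clamp-toℕ : ∀ {m} (i : Fin (suc m)) → clamp m (toℕ i) ≡ i
  clamp-toℕ {m}     zero    = refl
  clamp-toℕ {suc m} (suc i) = cong suc (clamp-toℕ i)

  clamp-injective : ∀ {m a b} → a ℕ.≤ m → b ℕ.≤ m → clamp m a ≡ clamp m b → a ≡ b
  clamp-injective a≤m b≤m eq = trans (sym (toℕ-clamp a≤m)) (trans (cong toℕ eq) (toℕ-clamp b≤m))

  cnext-clamp : ∀ {m k} → k ℕ.< m → cnext (clamp m k) ≡ clamp m (suc k)
  cnext-clamp {suc m}       {zero}  _             = refl
  cnext-clamp {suc (suc m)} {suc k} (ℕ.s≤s k<m) rewrite cnext-clamp k<m = refl

  cnext-invariant : ∀ {m} {X : Set} (g : Fin (suc m) → X) → (∀ l → g (cnext l) ≡ g l) → ∀ l → g l ≡ g zero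
  cnext-invariant {m} g invariant l = trans (cong g (sym (clamp-toℕ l))) (along (toℕ l) (≤-pred (toℕ<n l)))
    where
    along : ∀ k → k ℕ.≤ m → g (clamp m k) ≡ g zero
    along zero    _   = refl
    along (suc k) k<m = trans (cong g (sym (cnext-clamp k<m))) (trans (invariant (clamp m k)) (along k (<⇒≤ k<m)))

  sumℚ-cnext : ∀ {m} (f : Fin (suc m) → ℚ) → sumℚ (f ∘ cnext) ≡ sumℚ f
  sumℚ-cnext {m} f = begin
    sumℚ (f ∘ cnext)
      ≡⟨ sumℚ-init-last (f ∘ cnext) ⟩
    sumℚ (f ∘ cnext ∘ inject₁) + f (cnext (fromℕ m))
      ≡⟨ cong₂ _+_ (sumℚ-cong (cong f ∘ cnext-inject₁)) (cong f (cnext-fromℕ m)) ⟩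
    sumℚ (f ∘ suc) + f zero
      ≡⟨ ℚP.+-comm (sumℚ (f ∘ suc)) (f zero) ⟩
    sumℚ f ∎
    where open ≡-Reasoning

module Walks {n : ℕ} (E : Fin n → Fin n → Set) where

  open import Data.List using (List; []; _∷_; length; allFin; filter)
  open import Data.List.Properties using (filter-notAll)
  open import Data.List.Membership.Propositional using (_∈_)
  open import Data.List.Membership.Propositional.Properties using (∈-allFin; ∈-filter⁺; ∈-filter⁻)
  open import Data.List.Membership.DecPropositional (F._≟_ {n}) using (_∈?_)
  import Data.List.Relation.Unary.Any as Any
  open import Data.Nat.Properties using (≤-trans; ≤-refl; <⇒≱; ≤-pred)
  open import Relation.Nullary.Decidable using (¬?; _×-dec_)

  infixr 5 _∷_
  data Walk : Fin n → Fin n → Set where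
    []  : ∀ {x} → Walk x x
    _∷_ : ∀ {x y z} → E x y → Walk y z → Walk x z

  infixr 5 _++ʷ_
  _++ʷ_ : ∀ {x y z} → Walk x y → Walk y z → Walk x z
  []      ++ʷ q = q
  (e ∷ p) ++ʷ q = e ∷ (p ++ʷ q)

  reverseʷ : (∀ {a b} → E a b → E b a) → ∀ {x y} → Walk x y → Walk y x
  reverseʷ E-sym []      = []
  reverseʷ E-sym (e ∷ p) = reverseʷ E-sym p ++ʷ (E-sym e ∷ [])

  module _ (E? : ∀ a b → Dec (E a b)) where

    private
      data WalkIn (U : List (Fin n)) : Fin n → Fin n → Set where
        stop : ∀ {x} → x ∈ U → WalkIn U x x
        step : ∀ {x y z} → x ∈ U → E x y → WalkIn U y z → WalkIn U x z

      _─_ : List (Fin n) → Fin n → List (Fin n)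
      U ─ x = filter (λ y → ¬? (y F.≟ x)) U

      start∈ : ∀ {U x y} → WalkIn U x y → x ∈ U
      start∈ (stop x∈U)     = x∈U
      start∈ (step x∈U _ _) = x∈U

      forget : ∀ {U x y} → WalkIn U x y → Walk x y
      forget (stop _)     = []
      forget (step _ e p) = e ∷ forget p

      within-all : ∀ {x y} → Walk x y → WalkIn (allFin n) x y
      within-all []      = stop (∈-allFin _)
      within-all (e ∷ p) = step (∈-allFin _) e (within-all p)

      widen : ∀ {U x y} z → WalkIn (U ─ z) x y → WalkIn U x y
      widen z (stop x∈)     = stop (proj₁ (∈-filter⁻ _ x∈))
      widen z (step x∈ e p) = step (proj₁ (∈-filter⁻ _ x∈)) e (widen z p)

      -- the part of a walk after its last visit to x avoids x
      after-last-visit : ∀ {U a y} x → WalkIn U a y → y ≢ x →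
        (a ≢ x × WalkIn (U ─ x) a y) ⊎ (∃ λ z → E x z × WalkIn (U ─ x) z y)
      after-last-visit x (stop y∈) y≢x = inj₁ (y≢x , stop (∈-filter⁺ _ y∈ y≢x))
      after-last-visit {a = a} x (step a∈ e p) y≢x with after-last-visit x p y≢x
      ... | inj₂ later = inj₂ later
      ... | inj₁ (z≢x , p') with a F.≟ x
      ...   | yes refl = inj₂ (_ , e , p')
      ...   | no a≢x   = inj₁ (a≢x , step (∈-filter⁺ _ a∈ a≢x) e p')

      ─-shrinks : ∀ {x U} → x ∈ U → length (U ─ x) ℕ.< length U
      ─-shrinks x∈U = filter-notAll _ _ (Any.map (λ { refl y≢y → y≢y refl }) x∈U)

      walkIn? : ∀ k U → length U ℕ.≤ k → ∀ x y → Dec (WalkIn U x y)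
      walkIn? k U |U|≤k x y with x ∈? U
      ... | no x∉U = no (x∉U ∘ start∈)
      ... | yes x∈U with x F.≟ y
      ...   | yes refl = yes (stop x∈U)
      walkIn? zero U |U|≤k x y | yes x∈U | no x≢y =
        contradiction (≤-trans |U|≤k ℕ.z≤n) (<⇒≱ (─-shrinks x∈U))
      walkIn? (suc k) U |U|≤k x y | yes x∈U | no x≢y
        with any? (λ z → E? x z ×-dec walkIn? k (U ─ x) shrunk z y)
        where
        shrunk : length (U ─ x) ℕ.≤ k
        shrunk = ≤-pred (≤-trans (─-shrinks x∈U) |U|≤k)
      ... | yes (z , e , p) = yes (step x∈U e (widen x p))
      ... | no ¬step = no λ p → case (after-last-visit x p (x≢y ∘ sym))
        where
        case : (x ≢ x × WalkIn (U ─ x) x y) ⊎ (∃ λ z → E x z × WalkIn (U ─ x) z y) → ⊥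
        case (inj₁ (x≢x , _)) = x≢x refl
        case (inj₂ found)     = ¬step found

    reachable? : ∀ x y → Dec (Walk x y)
    reachable? x y with walkIn? (length (allFin n)) (allFin n) ≤-refl x y
    ... | yes p = yes (forget p)
    ... | no ¬p = no (¬p ∘ within-all)

module Lists {X : Set} where

  open CyclicOrder using (lastView; inner; last; cnext-inject₁; cnext-fromℕ)
  open import Data.List using (List; []; _∷_; _++_; [_]; length; lookup)
  open import Data.List.Membership.Propositional using (_∈_)
  open import Data.List.Membership.Propositional.Properties using (∈-lookup)
  open import Data.List.Relation.Unary.All.Properties using (All¬⇒¬Any)
  open import Data.List.Relation.Unary.Linked using (Linked; []; [-]; _∷_)
  open import Data.List.Relation.Unary.Unique.Propositional using (Unique)
  open import Data.List.Relation.Unary.AllPairs using (_∷_)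

  private variable
    R : X → X → Set

  data Consecutive : List X → X → X → Set where
    here  : ∀ {p q xs} → Consecutive (p ∷ q ∷ xs) p q
    there : ∀ {x xs p q} → Consecutive xs p q → Consecutive (x ∷ xs) p q

  data Last : List X → X → Set where
    end  : ∀ {x} → Last [ x ] x
    skip : ∀ {x y xs t} → Last (y ∷ xs) t → Last (x ∷ y ∷ xs) t

  Linked-consecutive : ∀ {xs p q} → Linked R xs → Consecutive xs p q → R p q
  Linked-consecutive (Rpq ∷ _)  here      = Rpq
  Linked-consecutive (_ ∷ Rxs) (there c) = Linked-consecutive Rxs c

  consecutive-++ˡ : ∀ {xs p q} ys → Consecutive xs p q → Consecutive (xs ++ ys) p q
  consecutive-++ˡ ys here      = here
  consecutive-++ˡ ys (there c) = there (consecutive-++ˡ ys c)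

  consecutive-++ʳ : ∀ xs {ys p q} → Consecutive ys p q → Consecutive (xs ++ ys) p q
  consecutive-++ʳ []       c = c
  consecutive-++ʳ (x ∷ xs) c = there (consecutive-++ʳ xs c)

  Last-consecutive : ∀ {xs t} h → Last xs t → Consecutive (xs ++ [ h ]) t h
  Last-consecutive h end      = here
  Last-consecutive h (skip l) = there (Last-consecutive h l)

  Last-++ : ∀ xs {ys t} → Last ys t → Last (xs ++ ys) t
  Last-++ []           l = l
  Last-++ (x ∷ [])     l@end      = skip l
  Last-++ (x ∷ [])     l@(skip _) = skip l
  Last-++ (x ∷ y ∷ xs) l = skip (Last-++ (y ∷ xs) l)

  Linked-snoc : ∀ {xs t h} → Linked R xs → Last xs t → R t h → Linked R (xs ++ [ h ])
  Linked-snoc [-]         end      Rth = Rth ∷ [-]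
  Linked-snoc (Rxy ∷ Rxs) (skip l) Rth = Rxy ∷ Linked-snoc Rxs l Rth

  Linked-join : ∀ xs {s ys} → Linked R (xs ++ [ s ]) → Linked R (s ∷ ys) → Linked R (xs ++ s ∷ ys)
  Linked-join []           _           Rsys = Rsys
  Linked-join (x ∷ [])     (Rxs ∷ _)   Rsys = Rxs ∷ Rsys
  Linked-join (x ∷ y ∷ xs) (Rxy ∷ Rys) Rsys = Rxy ∷ Linked-join (y ∷ xs) Rys Rsys

  Linked-suffix : ∀ xs {ys} → Linked R (xs ++ ys) → Linked R ys
  Linked-suffix []           Rys = Rys
  Linked-suffix (x ∷ [])     {[]}    _         = []
  Linked-suffix (x ∷ [])     {y ∷ ys} (_ ∷ Rys) = Rys
  Linked-suffix (x ∷ y ∷ xs) (_ ∷ Rxs) = Linked-suffix (y ∷ xs) Rxs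

  Unique-suffix : ∀ xs {ys : List X} → Unique (xs ++ ys) → Unique ys
  Unique-suffix []       u       = u
  Unique-suffix (x ∷ xs) (_ ∷ u) = Unique-suffix xs u

  front : X → List X → X
  front s []      = s
  front s (r ∷ _) = r

  consecutive⇒Linked : ∀ {xs} → (∀ {p q} → Consecutive xs p q → R p q) → Linked R xs
  consecutive⇒Linked {xs = []}         _   = []
  consecutive⇒Linked {xs = x ∷ []}     _   = [-]
  consecutive⇒Linked {xs = x ∷ y ∷ xs} all = all here ∷ consecutive⇒Linked (all ∘ there)

  lookup-injective : ∀ {xs : List X} → Unique xs → ∀ i j → lookup xs i ≡ lookup xs j → i ≡ j
  lookup-injective {x ∷ xs} _          zero    zero    _  = refl
  lookup-injective {x ∷ xs} (x∉ ∷ _)   zero    (suc j) eq =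
    contradiction (∈-lookup j) (All¬⇒¬Any x∉ ∘ subst (_∈ xs) (sym eq))
  lookup-injective {x ∷ xs} (x∉ ∷ _)   (suc i) zero    eq =
    contradiction (∈-lookup i) (All¬⇒¬Any x∉ ∘ subst (_∈ xs) eq)
  lookup-injective {x ∷ xs} (_ ∷ uxs)  (suc i) (suc j) eq = cong suc (lookup-injective uxs i j eq)

  module _ (x : X) where

    consecutive-cyclic : ∀ xs (i : Fin (suc (length xs))) →
      Consecutive (x ∷ xs ++ [ x ]) (lookup (x ∷ xs) i) (lookup (x ∷ xs) (cnext i))
    consecutive-cyclic xs i with lastView i
    ... | inner j rewrite cnext-inject₁ j = inner-pair x xs j
      where
      inner-pair : ∀ y ys (j : Fin (length ys)) →
        Consecutive (y ∷ ys ++ [ x ]) (lookup (y ∷ ys) (inject₁ j)) (lookup (y ∷ ys) (suc j))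
      inner-pair y (z ∷ ys) zero    = here
      inner-pair y (z ∷ ys) (suc j) = there (inner-pair z ys j)
    ... | last rewrite cnext-fromℕ (length xs) = last-pair x xs
      where
      last-pair : ∀ y ys → Consecutive (y ∷ ys ++ [ x ]) (lookup (y ∷ ys) (fromℕ (length ys))) x
      last-pair y []       = here
      last-pair y (z ∷ ys) = there (last-pair z ys)

    cyclic-consecutive : ∀ xs {p q} → Consecutive (x ∷ xs ++ [ x ]) p q →
      ∃ λ i → lookup (x ∷ xs) i ≡ p × lookup (x ∷ xs) (cnext i) ≡ q
    cyclic-consecutive xs c with position x xs c
      where
      position : ∀ y ys {p q} → Consecutive (y ∷ ys ++ [ x ]) p q →
        (∃ λ j → lookup (y ∷ ys) (inject₁ j) ≡ p × lookup (y ∷ ys) (suc j) ≡ q) ⊎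
        (lookup (y ∷ ys) (fromℕ (length ys)) ≡ p × x ≡ q)
      position y []       here              = inj₂ (refl , refl)
      position y []       (there (there ()))
      position y (z ∷ ys) here              = inj₁ (zero , refl , refl)
      position y (z ∷ ys) (there c) with position z ys c
      ... | inj₁ (j , eqs) = inj₁ (suc j , eqs)
      ... | inj₂ eqs       = inj₂ eqs
    ... | inj₁ (j , p≡ , q≡) = inject₁ j , p≡ , trans (cong (lookup (x ∷ xs)) (cnext-inject₁ j)) q≡
    ... | inj₂ (p≡ , q≡)     = fromℕ (length xs) , p≡ , trans (cong (lookup (x ∷ xs)) (cnext-fromℕ (length xs))) q≡

module FirstHit {n} (E : Fin n → Fin n → Set) (E-sym : ∀ {a b} → E a b → E b a)
                {Z : Fin n → Set} (Z? : ∀ v → Dec (Z v)) (s : Fin n) where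

  open import Data.List using (List; []; _∷_; _++_; [_])
  open import Data.List.Properties using (++-assoc)
  open import Data.List.Membership.Propositional using (_∈_; _∉_)
  open import Data.List.Membership.Propositional.Properties using (∈-∃++; ∈-++⁺ʳ)
  open import Data.List.Membership.DecPropositional (F._≟_ {n}) using (_∈?_)
  open import Data.List.Relation.Unary.Any using (here; there)
  open import Data.List.Relation.Unary.All.Properties using (¬Any⇒All¬)
  open import Data.List.Relation.Unary.Linked using (Linked; []; [-]; _∷_)
  open import Data.List.Relation.Unary.Unique.Propositional using (Unique)
  open import Data.List.Relation.Unary.AllPairs using ([]; _∷_)
  open Walks E using (Walk; []; _∷_)
  open Lists

  -- R is the interior of a simple path from s, listed backwards
  record Backtrack (R : List (Fin n)) : Set where
    field
      unique  : Unique R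
      outside : ∀ {v} → v ∈ R → ¬ Z v × v ≢ s
      linked  : Linked E (R ++ [ s ])

  record Hit : Set where
    field
      target    : Fin n
      interior  : List (Fin n)
      on-target : Z target
      target≢s  : target ≢ s
      backtrack : Backtrack interior
      last-edge : E (front s interior) target

  private
    start : Backtrack []
    start = record { unique = [] ; outside = λ () ; linked = [-] }

    extend : ∀ {R b} → Backtrack R → E (front s R) b → b ∉ R → ¬ Z b → b ≢ s → Backtrack (b ∷ R)
    extend {R} {b} P e b∉R ¬Zb b≢s = record
      { unique  = ¬Any⇒All¬ R b∉R ∷ unique
      ; outside = λ { (here refl) → ¬Zb , b≢s ; (there v∈R) → outside v∈R }
      ; linked  = linked-∷ R (E-sym e) linked
      }
      where
      open Backtrack P
      linked-∷ : ∀ R → E b (front s R) → Linked E (R ++ [ s ]) → Linked E (b ∷ R ++ [ s ])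
      linked-∷ []      e′ _  = e′ ∷ [-]
      linked-∷ (r ∷ R) e′ ER = e′ ∷ ER

    cut-loop : ∀ pre {b post} → Backtrack (pre ++ b ∷ post) → Backtrack (b ∷ post)
    cut-loop pre {b} {post} P = record
      { unique  = Unique-suffix pre unique
      ; outside = outside ∘ ∈-++⁺ʳ pre
      ; linked  = Linked-suffix pre (subst (Linked E) (++-assoc pre (b ∷ post) [ s ]) linked)
      }
      where open Backtrack P

  -- a walk from s to Z is shortened, by erasing loops, to a simple path whose interior avoids Z and s
  first-hit : ∀ R → Backtrack R → ∀ {y} → Walk (front s R) y → Z y → y ≢ s → Hit
  first-hit []      _ [] _  y≢s = contradiction refl y≢s
  first-hit (r ∷ R) P [] Zy _   = contradiction Zy (proj₁ (Backtrack.outside P (here refl)))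
  first-hit R P (_∷_ {y = b} e w) Zy y≢s with b F.≟ s
  ... | yes refl = first-hit [] start w Zy y≢s
  ... | no b≢s with Z? b
  ...   | yes Zb = record
    { target = b ; interior = R ; on-target = Zb ; target≢s = b≢s ; backtrack = P ; last-edge = e }
  ...   | no ¬Zb with b ∈? R
  ...     | no b∉R = first-hit (b ∷ R) (extend P e b∉R ¬Zb b≢s) w Zy y≢s
  ...     | yes b∈R with ∈-∃++ b∈R
  ...       | pre , post , refl = first-hit (b ∷ post) (cut-loop pre P) w Zy y≢s

  hit : ∀ {y} → Walk s y → Z y → y ≢ s → Hit
  hit = first-hit [] start

module Cactus {n : ℕ} (A : Mat n) (A-signed : IsSignedGraph A) (A-cactus : IsCactus A) where

  open RationalFacts
  open Sums
  open NetLaplacian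
  open CyclicOrder
  open Lists
  open import Data.List using (List; []; _∷_; _++_; [_]; length; lookup)
  open import Data.List.Properties using (++-assoc; length-++)
  open import Data.List.Membership.Propositional using (_∈_; _∉_)
  open import Data.List.Relation.Unary.Any using (here; there)
  open import Data.List.Relation.Unary.Linked as Linked using (Linked)
  open import Data.List.Relation.Unary.Unique.Propositional using (Unique)
  import Data.List.Relation.Unary.Unique.Propositional.Properties as Unique
  open import Data.List.Relation.Binary.Disjoint.Propositional using (Disjoint)
  open import Data.Nat.Properties
    using (≤-pred; ≤-trans; ≤-refl; <⇒≤; <⇒≢; <-trans; <-≤-trans; <-cmp; n<1+n; n≤1+n; m≤n+m; m≤m+n; m<m+n;
           +-suc; +-identityʳ; +-monoʳ-≤; m≤n⇒∃[o]m+o≡n)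
  open import Data.Fin.Properties using (toℕ<n; toℕ-injective)
  open import Data.List.Relation.Unary.All.Properties using (¬Any⇒All¬)
  open import Data.List.Relation.Unary.AllPairs using ([]; _∷_)
  import Data.List.Relation.Unary.All as All
  open import Relation.Binary.Definitions using (tri<; tri≈; tri>)
  open import Function.Bundles using (Equivalence)
  open import Data.Bool using (if_then_else_)
  open import Data.Sum using ([_,_]′)
  open import Relation.Nullary.Decidable using (⌊_⌋; ¬?; _×-dec_; _⊎-dec_; decidable-stable)
  open ≡-Reasoning
  open F using (toℕ)

  A-sym : Symmetric A
  A-sym = proj₁ A-signed

  Adj? : ∀ a b → Dec (Adj A a b)
  Adj? a b = ¬? (A a b ℤ.≟ 0ℤ)

  Adj-sym : ∀ {a b} → Adj A a b → Adj A b a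
  Adj-sym {a} {b} Aab≢0 Aba≡0 = Aab≢0 (trans (A-sym a b) Aba≡0)

  Adj-irrefl : ∀ {a b} → Adj A a b → a ≢ b
  Adj-irrefl {a} Aaa≢0 refl = Aaa≢0 (proj₁ (proj₂ A-signed) a)

  EdgeOf-sym : ∀ (C : Cycle A) {a b} → EdgeOf C a b → EdgeOf C b a
  EdgeOf-sym C (i , inj₁ e) = i , inj₂ e
  EdgeOf-sym C (i , inj₂ e) = i , inj₁ e

  EdgeOf⇒Adj : ∀ (C : Cycle A) {a b} → EdgeOf C a b → Adj A a b
  EdgeOf⇒Adj C (i , inj₁ (refl , refl)) = adj C i
  EdgeOf⇒Adj C (i , inj₂ (refl , refl)) = Adj-sym (adj C i)

  EdgeOf? : ∀ (C : Cycle A) a b → Dec (EdgeOf C a b)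
  EdgeOf? C a b = any? λ i → ((vs C i F.≟ a) ×-dec (vs C (cnext i) F.≟ b)) ⊎-dec
                             ((vs C i F.≟ b) ×-dec (vs C (cnext i) F.≟ a))

  cactus-edges : ∀ (C C' : Cycle A) {p q} → EdgeOf C p q → EdgeOf C' p q → ∀ {a b} → EdgeOf C' a b → EdgeOf C a b
  cactus-edges C C' {p} {q} e e' {a} {b} = Equivalence.from (proj₂ A-cactus C C' (p , q , e , e') a b)

  closed-path-cycle : ∀ x L → 3 ℕ.≤ length (x ∷ L) → Unique (x ∷ L) → Linked (Adj A) (x ∷ L ++ [ x ]) →
                      Σ (Cycle A) λ C → ∀ {p q} → Consecutive (x ∷ L ++ [ x ]) p q → EdgeOf C p q
  closed-path-cycle x L long unique linked = C , edges
    where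
    C : Cycle A
    C = record
      { m     = length L
      ; len≥3 = long
      ; vs    = lookup (x ∷ L)
      ; inj   = lookup-injective unique
      ; adj   = λ i → Linked-consecutive linked (consecutive-cyclic x L i)
      }
    edges : ∀ {p q} → Consecutive (x ∷ L ++ [ x ]) p q → EdgeOf C p q
    edges c with i , p≡ , q≡ ← cyclic-consecutive x L c = i , inj₁ (p≡ , q≡)

  -- a path R ++ [ s ] into s, followed by a path s ∷ P from s to t, closed up by an edge from t
  close-up : ∀ {s t} R P → Unique R → Linked (Adj A) (R ++ [ s ]) →
             Unique (s ∷ P) → (∀ {p q} → Consecutive (s ∷ P) p q → Adj A p q) → Last (s ∷ P) t →
             Disjoint R (s ∷ P) → Adj A t (front s R) → 3 ℕ.≤ length (R ++ s ∷ P) →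
             Σ (Cycle A) λ C → EdgeOf C t (front s R) × (∀ {p q} → Consecutive (s ∷ P) p q → EdgeOf C p q)
  close-up {s} {t} [] P _ _ uP adjP lastP _ closing long =
    C , edges (Last-consecutive s lastP) , edges ∘ consecutive-++ˡ [ s ]
    where
    open Σ (closed-path-cycle s P long uP (Linked-snoc (consecutive⇒Linked adjP) lastP closing))
      renaming (proj₁ to C; proj₂ to edges)
  close-up {s} {t} (r ∷ R) P uR linkedR uP adjP lastP disjoint closing long =
    C , edges (Last-consecutive r (Last-++ (r ∷ R) lastP)) ,
    λ c → edges (subst (λ xs → Consecutive (r ∷ xs) _ _) (sym (++-assoc R (s ∷ P) [ r ]))
                       (consecutive-++ʳ (r ∷ R) (consecutive-++ˡ [ r ] c)))
    where
    linked : Linked (Adj A) (r ∷ (R ++ s ∷ P) ++ [ r ])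
    linked = subst (λ xs → Linked (Adj A) (r ∷ xs)) (sym (++-assoc R (s ∷ P) [ r ]))
                   (Linked-join (r ∷ R) linkedR (Linked-snoc (consecutive⇒Linked adjP) lastP closing))
    open Σ (closed-path-cycle r (R ++ s ∷ P) long (Unique.++⁺ uR uP disjoint) linked)
      renaming (proj₁ to C; proj₂ to edges)

  cycle-length : ∀ {s t : Fin n} R P → Last (s ∷ P) t → t ≢ s → (R ≡ [] → P ≢ [ t ]) →
                 3 ℕ.≤ length (R ++ s ∷ P)
  cycle-length []      []            end          t≢s _     = contradiction refl t≢s
  cycle-length []      (p ∷ [])      (skip end)   _   short = contradiction refl (short refl)
  cycle-length []      (p ∷ q ∷ P)   _            _   _     = ℕ.s≤s (ℕ.s≤s (ℕ.s≤s ℕ.z≤n))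
  cycle-length (r ∷ R) []            end          t≢s _     = contradiction refl t≢s
  cycle-length (r ∷ R) (p ∷ P)       _            _   _     =
    ℕ.s≤s (subst (2 ℕ.≤_) (sym (length-++ R)) (≤-trans (m≤m+n 2 (length P)) (m≤n+m (2 ℕ.+ length P) (length R))))

  module CycleFacts (C : Cycle A) where

    M≥2 : 2 ℕ.≤ m C
    M≥2 = ≤-pred (len≥3 C)

    OnCycle : Fin n → Set
    OnCycle v = ∃ λ l → vs C l ≡ v

    onCycle? : ∀ v → Dec (OnCycle v)
    onCycle? v = any? λ l → vs C l F.≟ v

    OffEdge : Fin n → Fin n → Set
    OffEdge a b = Adj A a b × ¬ EdgeOf C a b

    offEdge? : ∀ a b → Dec (OffEdge a b)
    offEdge? a b = Adj? a b ×-dec ¬? (EdgeOf? C a b)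

    OffEdge-sym : ∀ {a b} → OffEdge a b → OffEdge b a
    OffEdge-sym (Aab , ¬Cab) = Adj-sym Aab , ¬Cab ∘ EdgeOf-sym C

    open Walks OffEdge public using ([]; _∷_; _++ʷ_; reverseʷ) renaming (Walk to Reach)

    reach? : ∀ a b → Dec (Reach a b)
    reach? = Walks.reachable? OffEdge offEdge?

    private
      M : ℕ
      M = m C

      W : ℕ → Fin n
      W k = vs C (clamp M k)

      W-injective : ∀ {a b} → a ℕ.≤ M → b ℕ.≤ M → W a ≡ W b → a ≡ b
      W-injective a≤M b≤M eq = clamp-injective a≤M b≤M (inj C _ _ eq)

      W-edge : ∀ {k} → k ℕ.< M → EdgeOf C (W k) (W (suc k))
      W-edge {k} k<M = clamp M k , inj₁ (refl , cong (vs C) (cnext-clamp k<M))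

    record Arc (s t : Fin n) : Set where
      field
        rest     : List (Fin n)
        unique   : Unique (s ∷ rest)
        along    : ∀ {p q} → Consecutive (s ∷ rest) p q → EdgeOf C p q
        ends     : Last (s ∷ rest) t
        on-cycle : ∀ {v} → v ∈ s ∷ rest → OnCycle v

    private
      W-toℕ : ∀ l → W (toℕ l) ≡ vs C l
      W-toℕ l = cong (vs C) (clamp-toℕ l)

      toℕ≤M : ∀ (l : Fin (suc M)) → toℕ l ℕ.≤ M
      toℕ≤M l = ≤-pred (toℕ<n l)

      W-on-cycle : ∀ {v} k → v ≡ W k → OnCycle v
      W-on-cycle k refl = clamp M k , refl

      ascent : ℕ → ℕ → List (Fin n)
      ascent a zero    = []
      ascent a (suc k) = W (suc a) ∷ ascent (suc a) k

      ascent-∈ : ∀ a k {v} → v ∈ ascent a k → ∃ λ j → a ℕ.< j × j ℕ.≤ a ℕ.+ k × v ≡ W j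
      ascent-∈ a (suc k) (here refl) =
        suc a , ≤-refl , subst (suc a ℕ.≤_) (sym (+-suc a k)) (ℕ.s≤s (m≤m+n a k)) , refl
      ascent-∈ a (suc k) (there v∈) with j , a<j , j≤ , v≡ ← ascent-∈ (suc a) k v∈ =
        j , <-trans (n<1+n a) a<j , subst (j ℕ.≤_) (sym (+-suc a k)) j≤ , v≡

      ascent-arc : ∀ a k → a ℕ.+ k ℕ.≤ M → Arc (W a) (W (a ℕ.+ k))
      ascent-arc a k a+k≤M = record
        { rest     = ascent a k
        ; unique   = unique a k a+k≤M
        ; along    = along a k a+k≤M
        ; ends     = ends a k
        ; on-cycle = λ { (here v≡)  → W-on-cycle a v≡
                       ; (there v∈) → W-on-cycle _ (proj₂ (proj₂ (proj₂ (ascent-∈ a k v∈)))) }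
        }
        where
        unique : ∀ a k → a ℕ.+ k ℕ.≤ M → Unique (W a ∷ ascent a k)
        unique a zero    _     = All.[] ∷ []
        unique a (suc k) a+k≤M = ¬Any⇒All¬ _ fresh ∷ unique (suc a) k (subst (ℕ._≤ M) (+-suc a k) a+k≤M)
          where
          fresh : W a ∉ ascent a (suc k)
          fresh v∈ with j , a<j , j≤ , Wa≡Wj ← ascent-∈ a (suc k) v∈ =
            <⇒≢ a<j (W-injective (≤-trans (m≤m+n a (suc k)) a+k≤M) (≤-trans j≤ a+k≤M) Wa≡Wj)
        along : ∀ a k → a ℕ.+ k ℕ.≤ M → ∀ {p q} → Consecutive (W a ∷ ascent a k) p q → EdgeOf C p q
        along a zero    _     (there ())
        along a (suc k) a+k≤M here      = W-edge (<-≤-trans (m<m+n a ℕ.z<s) a+k≤M)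
        along a (suc k) a+k≤M (there c) = along (suc a) k (subst (ℕ._≤ M) (+-suc a k) a+k≤M) c
        ends : ∀ a k → Last (W a ∷ ascent a k) (W (a ℕ.+ k))
        ends a zero    = subst (Last [ W a ] ∘ W) (sym (+-identityʳ a)) end
        ends a (suc k) = skip (subst (Last (ascent a (suc k)) ∘ W) (sym (+-suc a k)) (ends (suc a) k))

      descent : ℕ → ℕ → List (Fin n)
      descent c zero    = []
      descent c (suc k) = W (c ℕ.+ k) ∷ descent c k

      descent-∈ : ∀ c k {v} → v ∈ descent c k → ∃ λ j → j ℕ.< c ℕ.+ k × v ≡ W j
      descent-∈ c (suc k) (here refl) = c ℕ.+ k , subst (c ℕ.+ k ℕ.<_) (sym (+-suc c k)) (n<1+n (c ℕ.+ k)) , refl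
      descent-∈ c (suc k) (there v∈) with j , j< , v≡ ← descent-∈ c k v∈ =
        j , <-trans j< (subst (c ℕ.+ k ℕ.<_) (sym (+-suc c k)) (n<1+n (c ℕ.+ k))) , v≡

      descent-arc : ∀ c k → c ℕ.+ k ℕ.≤ M → Arc (W (c ℕ.+ k)) (W c)
      descent-arc c k c+k≤M = record
        { rest     = descent c k
        ; unique   = unique k c+k≤M
        ; along    = along k c+k≤M
        ; ends     = ends k
        ; on-cycle = λ { (here v≡)  → W-on-cycle (c ℕ.+ k) v≡
                       ; (there v∈) → W-on-cycle _ (proj₂ (proj₂ (descent-∈ c k v∈))) }
        }
        where
        shorter : ∀ k → c ℕ.+ suc k ℕ.≤ M → c ℕ.+ k ℕ.≤ M
        shorter k = ≤-trans (+-monoʳ-≤ c (n≤1+n k))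
        unique : ∀ k → c ℕ.+ k ℕ.≤ M → Unique (W (c ℕ.+ k) ∷ descent c k)
        unique zero    _     = All.[] ∷ []
        unique (suc k) c+k≤M = ¬Any⇒All¬ _ fresh ∷ unique k (shorter k c+k≤M)
          where
          fresh : W (c ℕ.+ suc k) ∉ descent c (suc k)
          fresh v∈ with j , j< , W≡Wj ← descent-∈ c (suc k) v∈ =
            <⇒≢ j< (sym (W-injective c+k≤M (≤-trans (<⇒≤ j<) c+k≤M) W≡Wj))
        along : ∀ k → c ℕ.+ k ℕ.≤ M → ∀ {p q} → Consecutive (W (c ℕ.+ k) ∷ descent c k) p q → EdgeOf C p q
        along zero    _     (there ())
        along (suc k) c+k≤M here      = subst (λ j → EdgeOf C (W j) (W (c ℕ.+ k))) (sym (+-suc c k))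
                                              (EdgeOf-sym C (W-edge (subst (ℕ._≤ M) (+-suc c k) c+k≤M)))
        along (suc k) c+k≤M (there p) = along k (shorter k c+k≤M) p
        ends : ∀ k → Last (W (c ℕ.+ k) ∷ descent c k) (W c)
        ends zero    = subst (λ j → Last [ W j ] (W c)) (sym (+-identityʳ c)) end
        ends (suc k) = skip (ends k)

    arc : ∀ {l i} → l ≢ i → Arc (vs C l) (vs C i)
    arc {l} {i} l≢i with <-cmp (toℕ l) (toℕ i)
    ... | tri≈ _ l≡i _ = contradiction (toℕ-injective l≡i) l≢i
    ... | tri< l<i _ _ with k , l+k≡i ← m≤n⇒∃[o]m+o≡n (<⇒≤ l<i) =
      subst₂ Arc (W-toℕ l) (trans (cong W l+k≡i) (W-toℕ i))
             (ascent-arc (toℕ l) k (subst (ℕ._≤ M) (sym l+k≡i) (toℕ≤M i)))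
    ... | tri> _ _ i<l with k , i+k≡l ← m≤n⇒∃[o]m+o≡n (<⇒≤ i<l) =
      subst₂ Arc (trans (cong W i+k≡l) (W-toℕ l)) (W-toℕ i)
             (descent-arc (toℕ i) k (subst (ℕ._≤ M) (sym i+k≡l) (toℕ≤M l)))

    -- otherwise the walk and an arc of C close up to a cycle sharing an edge with C without being C
    no-shortcut : ∀ {l l'} → Reach (vs C l) (vs C l') → l ≡ l'
    no-shortcut {l} {l'} w with l F.≟ l'
    ... | yes l≡l' = l≡l'
    ... | no l≢l'  = ⊥-elim (impossible (hit w (l' , refl) (l≢l' ∘ inj C _ _ ∘ sym)))
      where
      open FirstHit OffEdge OffEdge-sym onCycle? (vs C l)

      first-step : ∀ {s t} (a : Arc s t) → t ≢ s → ∃ λ q → Consecutive (s ∷ Arc.rest a) s q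
      first-step record { rest = []    ; ends = end } t≢s = contradiction refl t≢s
      first-step record { rest = q ∷ _ }              _   = q , here

      impossible : Hit → ⊥
      impossible record { target = t ; interior = R ; on-target = i , refl ; target≢s = t≢s
                        ; backtrack = P ; last-edge = offEdge } =
        proj₂ offEdge (EdgeOf-sym C (shared (close-up R rest (Backtrack.unique P) (Linked.map proj₁ linked)
          (Arc.unique a) (EdgeOf⇒Adj C ∘ along) ends (λ (v∈R , v∈a) → proj₁ (outside v∈R) (on-cycle v∈a))
          (Adj-sym (proj₁ offEdge)) (cycle-length R rest ends t≢s direct))))
        where
        open Backtrack P
        a : Arc (vs C l) (vs C i)
        a = arc (t≢s ∘ cong (vs C) ∘ sym)
        open Arc a
        direct : R ≡ [] → rest ≢ [ vs C i ]
        direct refl rest≡ = proj₂ offEdge (along (subst (λ r → Consecutive (vs C l ∷ r) _ _) (sym rest≡) here))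
        shared : (Σ (Cycle A) λ C' → EdgeOf C' (vs C i) (front (vs C l) R) ×
                                     (∀ {p q} → Consecutive (vs C l ∷ rest) p q → EdgeOf C' p q)) →
                 EdgeOf C (vs C i) (front (vs C l) R)
        shared (C' , closing , arc-edges) with q , first ← first-step a t≢s =
          cactus-edges C C' (along first) (arc-edges first) closing

    Branch : Fin (suc (m C)) → Fin n → Set
    Branch l = Reach (vs C l)

    cnext≢ : ∀ l → cnext l ≢ l
    cnext≢ l eq = Adj-irrefl (adj C l) (cong (vs C) (sym eq))

    EdgeOf-start : ∀ {i k} → EdgeOf C i k → OnCycle i
    EdgeOf-start (p , inj₁ (refl , _)) = p , refl
    EdgeOf-start (p , inj₂ (_ , refl)) = cnext p , refl

    cycle-neighbours : ∀ {l k} → EdgeOf C (vs C l) k → k ≡ vs C (cnext l) ⊎ k ≡ vs C (cprev l)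
    cycle-neighbours (p , inj₁ (p~l , refl)) = inj₁ (cong (vs C ∘ cnext) (inj C _ _ p~l))
    cycle-neighbours (p , inj₂ (refl , p+1~l)) =
      inj₂ (cong (vs C) (trans (sym (cprev-cnext p)) (cong cprev (inj C _ _ p+1~l))))

    neighbours-distinct : ∀ l → vs C (cnext l) ≢ vs C (cprev l)
    neighbours-distinct l = cnext≢cprev M≥2 l ∘ inj C _ _

    sum-around : ∀ q (f : Fin n → ℚ) → (∀ k → ¬ EdgeOf C (vs C q) k → f k ≡ 0ℚ) →
                 sumℚ f ≡ f (vs C (cnext q)) + f (vs C (cprev q))
    sum-around q f off-cycle = sumℚ-pair _ _ f (neighbours-distinct q) λ k k≢next k≢prev →
      off-cycle k (λ e → [ k≢next , k≢prev ]′ (cycle-neighbours e))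

    module Flow {B : Mat n} (B-sym : Symmetric B) (B⊆A : ∀ i k → B i k ≢ 0ℤ → Adj A i k)
                {x : Vecℚ n} (Bx : Ker B x) where

      along-edge : Fin (suc (m C)) → ℚ
      along-edge l = flow B x (vs C l) (vs C (cnext l))

      single-exit : ∀ l i k → Branch l i → ¬ Branch l k → B i k ≢ 0ℤ → i ≡ vs C l
      single-exit l i k reach-i ¬reach-k Bik≢0 with EdgeOf? C i k
      ... | no ¬Cik = contradiction (reach-i ++ʷ ((B⊆A i k Bik≢0 , ¬Cik) ∷ [])) ¬reach-k
      ... | yes Cik with q , refl ← EdgeOf-start Cik = cong (vs C) (sym (no-shortcut reach-i))

      -- the branch at vs C l is left only through the two edges of C at vs C l
      node-balance : ∀ l → along-edge l + flow B x (vs C l) (vs C (cprev l)) ≡ 0ℚ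
      node-balance l = begin
        along-edge l + flow B x c (vs C (cprev l))
          ≡⟨ cong₂ _+_ (leaving (cnext l) (cnext≢ l ∘ sym)) (leaving (cprev l) cprev≢) ⟨
        g (vs C (cnext l)) + g (vs C (cprev l))
          ≡⟨ sum-around l g off-cycle ⟨
        sumℚ g
          ≡⟨ Cut.flow-out-of-cut B-sym Bx (reach? c) c [] (single-exit l) ⟩
        0ℚ ∎
        where
        c : Fin n
        c = vs C l
        g : Fin n → ℚ
        g k = if ⌊ reach? c k ⌋ then 0ℚ else flow B x c k
        cprev≢ : l ≢ cprev l
        cprev≢ eq = cnext≢ l (trans (cong cnext eq) (cnext-cprev l))
        leaving : ∀ l' → l ≢ l' → g (vs C l') ≡ flow B x c (vs C l')
        leaving l' l≢l' with reach? c (vs C l')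
        ... | yes r = contradiction (no-shortcut r) l≢l'
        ... | no _  = refl
        off-cycle : ∀ k → ¬ EdgeOf C c k → g k ≡ 0ℚ
        off-cycle k ¬Cck with reach? c k
        ... | yes _ = refl
        ... | no ¬r with B c k ℤ.≟ 0ℤ
        ...   | yes Bck≡0 = flow-no-edge B x Bck≡0
        ...   | no Bck≢0  = contradiction ((B⊆A c k Bck≢0 , ¬Cck) ∷ []) ¬r

      along-edge-constant : ∀ l → along-edge l ≡ along-edge zero
      along-edge-constant = cnext-invariant along-edge λ l → p-q≡0⇒p≡q _ _ (begin
        along-edge (cnext l) - along-edge l
          ≡⟨ cong (along-edge (cnext l) +_) (sym (flow-antisym B-sym x (vs C l) (vs C (cnext l)))) ⟩
        along-edge (cnext l) + flow B x (vs C (cnext l)) (vs C l)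
          ≡⟨ cong (λ j → along-edge (cnext l) + flow B x (vs C (cnext l)) (vs C j)) (sym (cprev-cnext l)) ⟩
        along-edge (cnext l) + flow B x (vs C (cnext l)) (vs C (cprev (cnext l)))
          ≡⟨ node-balance (cnext l) ⟩
        0ℚ ∎)

    position-unique : ∀ {l p} → (vs C l ≡ vs C p × vs C (cnext l) ≡ vs C (cnext p)) ⊎
                                (vs C l ≡ vs C (cnext p) × vs C (cnext l) ≡ vs C p) → l ≡ p
    position-unique (inj₁ (l~p , _)) = inj C _ _ l~p
    position-unique {l} {p} (inj₂ (l~p+1 , l+1~p)) with refl ← inj C _ _ l~p+1 =
      contradiction (trans (sym (cprev-cnext (cnext p))) (cong cprev (inj C _ _ l+1~p))) (cnext≢cprev M≥2 p)

    Δ : Vecℚ n → Fin (suc (m C)) → ℚ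
    Δ x l = x (vs C l) - x (vs C (cnext l))

    telescope : ∀ x → sumℚ (Δ x) ≡ 0ℚ
    telescope x = begin
      sumℚ (Δ x)                                 ≡⟨ sumℚ-distrib-sub (x ∘ vs C) (x ∘ vs C ∘ cnext) ⟩
      sumℚ (x ∘ vs C) - sumℚ (x ∘ vs C ∘ cnext)  ≡⟨ cong (λ w → sumℚ (x ∘ vs C) - w) (sumℚ-cnext (x ∘ vs C)) ⟩
      sumℚ (x ∘ vs C) - sumℚ (x ∘ vs C)          ≡⟨ ℚP.+-inverseʳ (sumℚ (x ∘ vs C)) ⟩
      0ℚ                                         ∎

    entry≢0 : ∀ l → toℚ (A (vs C l) (vs C (cnext l))) ≢ 0ℚ
    entry≢0 l = adj C l ∘ toℚ≡0⇒≡0 _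

    deleted-edge-ends : ∀ {u v} → EdgeOf C u v → ∀ x → Ker (deleteEdge A u v) x → x u ≡ x v
    deleted-edge-ends {u} {v} (p , deleted) x Bx = ends deleted
      where
      open EdgeDeletion A u v
      open Flow (deleteEdge-sym A-sym) deleteEdge-support Bx
      flat : ∀ l → l ≢ p → Δ x l ≡ 0ℚ
      flat l l≢p = p≢0∧p*q≡0⇒q≡0 (entry≢0 l) (trans (cong (λ b → toℚ b * Δ x l) (sym kept)) no-flow)
        where
        kept : deleteEdge A u v (vs C l) (vs C (cnext l)) ≡ A (vs C l) (vs C (cnext l))
        kept = deleteEdge-off (l≢p ∘ position-unique ∘ λ e → IsEdge-unique e deleted)
        no-flow : along-edge l ≡ 0ℚ
        no-flow = trans (along-edge-constant l)
                   (trans (sym (along-edge-constant p)) (flow-no-edge (deleteEdge A u v) x (deleteEdge-on deleted)))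
      Δp≡0 : Δ x p ≡ 0ℚ
      Δp≡0 = trans (sym (sumℚ-single p (Δ x) flat)) (telescope x)
      ends : IsEdge (vs C p) (vs C (cnext p)) → x u ≡ x v
      ends (inj₁ (refl , refl)) = p-q≡0⇒p≡q _ _ Δp≡0
      ends (inj₂ (refl , refl)) = sym (p-q≡0⇒p≡q _ _ Δp≡0)

    Ker-deleteEdge⇒Ker : ∀ {u v} → EdgeOf C u v → ∀ {x} → Ker (deleteEdge A u v) x → Ker A x
    Ker-deleteEdge⇒Ker {u} {v} uv∈C {x} A'x =
      Ker-cong (EdgeDeletion.flow-deleteEdge A u v x (deleted-edge-ends uv∈C x A'x)) A'x

    σ : Fin (suc (m C)) → ℚ
    σ l = toℚ (edgeSign C l)

    edgeSign-±1 : ∀ l → edgeSign C l ≡ 1ℤ ⊎ edgeSign C l ≡ -1ℤ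
    edgeSign-±1 l with proj₂ (proj₂ A-signed) (vs C l) (vs C (cnext l))
    ... | inj₁ ≡0 = contradiction ≡0 (adj C l)
    ... | inj₂ ±1 = ±1

    σ²≡1 : ∀ l → σ l * σ l ≡ 1ℚ
    σ²≡1 l with edgeSign-±1 l
    ... | inj₁ ≡1  rewrite ≡1  = refl
    ... | inj₂ ≡-1 rewrite ≡-1 = refl

    σ≢0 : ∀ l → σ l ≢ 0ℚ
    σ≢0 l σ≡0 = contradiction (trans (sym (σ²≡1 l)) (cong (λ s → s * s) σ≡0)) λ ()

    sum-σ : sumℚ σ ≡ toℚ (ℤ.+ m⁺ C ℤ.- ℤ.+ m⁻ C)
    sum-σ = trans (sym (toℚ-sum (edgeSign C))) (cong toℚ (SignCount.sumℤ-signs (edgeSign C) edgeSign-±1))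

    unbalanced-flat : m⁺ C ≢ m⁻ C → ∀ x → Ker A x → ∀ l → x (vs C l) ≡ x (vs C (cnext l))
    unbalanced-flat unbalanced x Ax l =
      p-q≡0⇒p≡q _ _ (trans (Δ≡σD l) (trans (cong (σ l *_) D≡0) (ℚP.*-zeroʳ (σ l))))
      where
      open Flow A-sym (λ _ _ → id) Ax
      D : ℚ
      D = along-edge zero
      Δ≡σD : ∀ l → Δ x l ≡ σ l * D
      Δ≡σD l = begin
        Δ x l                  ≡⟨ ℚP.*-identityˡ (Δ x l) ⟨
        1ℚ * Δ x l             ≡⟨ cong (_* Δ x l) (σ²≡1 l) ⟨
        σ l * σ l * Δ x l      ≡⟨ ℚP.*-assoc (σ l) (σ l) (Δ x l) ⟩
        σ l * along-edge l     ≡⟨ cong (σ l *_) (along-edge-constant l) ⟩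
        σ l * D                ∎
      sum-σ≢0 : sumℚ σ ≢ 0ℚ
      sum-σ≢0 Σσ≡0 =
        unbalanced (ℤP.+-injective (ℤP.i-j≡0⇒i≡j _ _ (toℚ≡0⇒≡0 _ (trans (sym sum-σ) Σσ≡0))))
      D≡0 : D ≡ 0ℚ
      D≡0 = p≢0∧p*q≡0⇒q≡0 sum-σ≢0 (begin
        sumℚ σ * D              ≡⟨ *-distribʳ-sumℚ D σ ⟩
        sumℚ (λ l → σ l * D)    ≡⟨ sumℚ-cong (sym ∘ Δ≡σD) ⟩
        sumℚ (Δ x)              ≡⟨ telescope x ⟩
        0ℚ                      ∎)

    unbalanced-edge : m⁺ C ≢ m⁻ C → ∀ {x} → Ker A x → ∀ {a b} → EdgeOf C a b → x a ≡ x b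
    unbalanced-edge unbalanced {x} Ax (l , inj₁ (refl , refl)) = unbalanced-flat unbalanced x Ax l
    unbalanced-edge unbalanced {x} Ax (l , inj₂ (refl , refl)) = sym (unbalanced-flat unbalanced x Ax l)

    -- the potential rising by σ l along the l-th edge of C and constant on each branch hanging off C
    module Balanced (balanced : m⁺ C ≡ m⁻ C) where

      P : Fin (suc (m C)) → ℚ
      P = partialSum (σ ∘ inject₁)

      P-step : ∀ l → P (cnext l) ≡ P l + σ l
      P-step l with lastView l
      ... | inner i = trans (cong P (cnext-inject₁ i)) (partialSum-suc (σ ∘ inject₁) i)
      ... | last    = trans (cong P (cnext-fromℕ (m C))) (sym (begin
        P (fromℕ (m C)) + σ (fromℕ (m C))     ≡⟨ cong (_+ σ (fromℕ (m C))) (partialSum-last (σ ∘ inject₁)) ⟩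
        sumℚ (σ ∘ inject₁) + σ (fromℕ (m C))  ≡⟨ sumℚ-init-last σ ⟨
        sumℚ σ                                ≡⟨ sum-σ ⟩
        toℚ (ℤ.+ m⁺ C ℤ.- ℤ.+ m⁻ C)           ≡⟨ cong (λ a → toℚ (ℤ.+ a ℤ.- ℤ.+ m⁻ C)) balanced ⟩
        toℚ (ℤ.+ m⁻ C ℤ.- ℤ.+ m⁻ C)           ≡⟨ cong toℚ (ℤP.+-inverseʳ (ℤ.+ m⁻ C)) ⟩
        0ℚ                                    ∎))

      potential : Vecℚ n
      potential v with any? (λ l → reach? (vs C l) v)
      ... | yes (l , _) = P l
      ... | no _        = 0ℚ

      potential-branch : ∀ {l v} → Branch l v → potential v ≡ P l
      potential-branch {l} {v} r with any? (λ l → reach? (vs C l) v)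
      ... | yes (l' , r') = cong P (no-shortcut (r' ++ʷ reverseʷ OffEdge-sym r))
      ... | no none       = contradiction (l , r) none

      potential-off : ∀ {i k} → OffEdge i k → potential i ≡ potential k
      potential-off {i} {k} e with any? (λ l → reach? (vs C l) i)
      ... | yes (l , r) = sym (potential-branch (r ++ʷ e ∷ []))
      ... | no none with any? (λ l → reach? (vs C l) k)
      ...   | yes (l , r) = contradiction (l , r ++ʷ OffEdge-sym e ∷ []) none
      ...   | no _        = refl

      separates : ∀ p → potential (vs C p) ≢ potential (vs C (cnext p))
      separates p eq = σ≢0 p (begin
        σ p
          ≡⟨ solve 2 (λ a s → s := (a :+ s) :- a) refl (P p) (σ p) ⟩
        (P p + σ p) - P p
          ≡⟨ cong₂ _-_ (trans (sym (P-step p)) (sym (potential-branch []))) (sym (potential-branch [])) ⟩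
        potential (vs C (cnext p)) - potential (vs C p)
          ≡⟨ cong (_- potential (vs C p)) (sym eq) ⟩
        potential (vs C p) - potential (vs C p)
          ≡⟨ ℚP.+-inverseʳ (potential (vs C p)) ⟩
        0ℚ ∎)

      Ker-potential : Ker A potential
      Ker-potential i = trans (netLaplacian-apply A potential i) (at (onCycle? i))
        where
        z : Vecℚ n
        z = potential
        off-cycle-flow : ∀ {i k} → ¬ EdgeOf C i k → flow A z i k ≡ 0ℚ
        off-cycle-flow {i} {k} ¬Cik with Adj? i k
        ... | yes Aik = flow-flat A z (potential-off (Aik , ¬Cik))
        ... | no ¬Aik = flow-no-edge A z (decidable-stable (A i k ℤ.≟ 0ℤ) ¬Aik)
        at : Dec (OnCycle i) → sumℚ (flow A z i) ≡ 0ℚ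
        at (no off)       = sumℚ-zero {f = flow A z i} λ k → off-cycle-flow (off ∘ EdgeOf-start)
        at (yes (q , refl)) = begin
          sumℚ (flow A z (vs C q))
            ≡⟨ sum-around q (flow A z (vs C q)) (λ k → off-cycle-flow) ⟩
          σ q * (z (vs C q) - z (vs C (cnext q))) + toℚ (A (vs C q) (vs C q')) * (z (vs C q) - z (vs C q'))
            ≡⟨ cong₂ (λ a b → σ q * (a - b) + toℚ (A (vs C q) (vs C q')) * (a - z (vs C q')))
                     (potential-branch []) (potential-branch []) ⟩
          σ q * (P q - P (cnext q)) + toℚ (A (vs C q) (vs C q')) * (P q - z (vs C q'))
            ≡⟨ cong₂ (λ a b → σ q * (P q - P (cnext q)) + toℚ a * (P q - b))
                     (A-sym (vs C q) (vs C q')) (potential-branch []) ⟩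
          σ q * (P q - P (cnext q)) + toℚ (A (vs C q') (vs C q)) * (P q - P q')
            ≡⟨ cong₂ (λ a b → σ q * (P q - a) + toℚ (A (vs C q') (vs C b)) * (P b - P q'))
                     (P-step q) (sym (cnext-cprev q)) ⟩
          σ q * (P q - (P q + σ q)) + σ q' * (P (cnext q') - P q')
            ≡⟨ cong (λ a → σ q * (P q - (P q + σ q)) + σ q' * (a - P q')) (P-step q') ⟩
          σ q * (P q - (P q + σ q)) + σ q' * ((P q' + σ q') - P q')
            ≡⟨ solve 4 (λ s s' a b → s :* (a :- (a :+ s)) :+ s' :* ((b :+ s') :- b) := s' :* s' :- s :* s)
                       refl (σ q) (σ q') (P q) (P q') ⟩
          σ q' * σ q' - σ q * σ q
            ≡⟨ cong₂ _-_ (σ²≡1 q') (σ²≡1 q) ⟩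
          0ℚ ∎
          where q' = cprev q

      potential-separates : ∀ {a b} → EdgeOf C a b → potential a ≢ potential b
      potential-separates (p , inj₁ (refl , refl)) = separates p
      potential-separates (p , inj₂ (refl , refl)) = separates p ∘ sym

  module EdgeOnCycleOrBridge {a b : Fin n} (Aab : Adj A a b) where

    open EdgeDeletion A a b using (IsEdge)

    Other : Fin n → Fin n → Set
    Other p q = Adj A p q × ¬ IsEdge p q

    other? : ∀ p q → Dec (Other p q)
    other? p q = Adj? p q ×-dec ¬? (EdgeDeletion.isEdge? A a b p q)

    Other-sym : ∀ {p q} → Other p q → Other q p
    Other-sym (Apq , ¬e) = Adj-sym Apq , ¬e ∘ EdgeDeletion.IsEdge-sym A a b

    open Walks Other public using (Walk; reachable?)
    open Walks Other using ([]; _∷_; _++ʷ_)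

    private
      b≢a : b ≢ a
      b≢a = Adj-irrefl Aab ∘ sym

    cycle-through : Walk a b → Σ (Cycle A) λ C → EdgeOf C a b
    cycle-through w with hit w refl b≢a
      where open FirstHit Other Other-sym (F._≟ b) a
    ... | record { interior = R ; on-target = refl ; backtrack = P ; last-edge = last-edge } =
      proj₁ cycle , proj₂ (proj₂ cycle) here
      where
      open FirstHit.Backtrack P
      direct : R ≡ [] → [ b ] ≢ [ b ]
      direct refl _ = proj₂ last-edge (inj₁ (refl , refl))
      disjoint : Disjoint R (a ∷ [ b ])
      disjoint (v∈R , here v≡a)         = proj₂ (outside v∈R) v≡a
      disjoint (v∈R , there (here v≡b)) = proj₁ (outside v∈R) v≡b
      cycle : Σ (Cycle A) λ C → EdgeOf C b (front a R) × (∀ {p q} → Consecutive (a ∷ [ b ]) p q → EdgeOf C p q)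
      cycle = close-up R [ b ] unique (Linked.map proj₁ linked) ((b≢a ∘ sym All.∷ All.[]) ∷ All.[] ∷ [])
                (λ { here → Aab ; (there (there ())) }) (skip end) disjoint (Adj-sym (proj₁ last-edge))
                (cycle-length R [ b ] (skip end) b≢a direct)

    module _ {x : Vecℚ n} (Ax : Ker A x) where

      bridge-flat : ¬ Walk a b → x a ≡ x b
      bridge-flat ¬w = p-q≡0⇒p≡q _ _ (p≢0∧p*q≡0⇒q≡0 (Aab ∘ toℚ≡0⇒≡0 _) (begin
        flow A x a b       ≡⟨ leaving ⟨
        g b                ≡⟨ sumℚ-single b g others ⟨
        sumℚ g             ≡⟨ Cut.flow-out-of-cut A-sym Ax (reachable? other? a) a [] single-exit ⟩
        0ℚ                 ∎))
        where
        g : Fin n → ℚ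
        g k = if ⌊ reachable? other? a k ⌋ then 0ℚ else flow A x a k
        leaving : g b ≡ flow A x a b
        leaving with reachable? other? a b
        ... | yes w = contradiction w ¬w
        ... | no _  = refl
        single-exit : ∀ i k → Walk a i → ¬ Walk a k → A i k ≢ 0ℤ → i ≡ a
        single-exit i k wi ¬wk Aik with EdgeDeletion.isEdge? A a b i k
        ... | no ¬e                 = contradiction (wi ++ʷ (Aik , ¬e) ∷ []) ¬wk
        ... | yes (inj₁ (i≡a , _))  = i≡a
        ... | yes (inj₂ (refl , _)) = contradiction wi ¬w
        others : ∀ k → k ≢ b → g k ≡ 0ℚ
        others k k≢b with reachable? other? a k
        ... | yes _ = refl
        ... | no ¬wk with A a k ℤ.≟ 0ℤ
        ...   | yes Aak≡0 = flow-no-edge A x Aak≡0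
        ...   | no Aak≢0 with EdgeDeletion.isEdge? A a b a k
        ...     | no ¬e                 = contradiction ((Aak≢0 , ¬e) ∷ []) ¬wk
        ...     | yes (inj₁ (_ , k≡b))  = contradiction k≡b k≢b
        ...     | yes (inj₂ (a≡b , _))  = contradiction (sym a≡b) b≢a

  module Unbalanced (unbalanced : ∀ (C : Cycle A) → m⁺ C ≢ m⁻ C) {x : Vecℚ n} (Ax : Ker A x) where

    edge-flat : ∀ {a b} → Adj A a b → x a ≡ x b
    edge-flat {a} {b} Aab = on-cycle-or-bridge (reachable? other? a b)
      where
      open EdgeOnCycleOrBridge Aab
      on-cycle-or-bridge : Dec (Walk a b) → x a ≡ x b
      on-cycle-or-bridge (no ¬w) = bridge-flat Ax ¬w
      on-cycle-or-bridge (yes w) with C , a~b ← cycle-through w = CycleFacts.unbalanced-edge C (unbalanced C) Ax a~b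

    walk-flat : ∀ k (w : Fin (suc k) → Fin n) → (∀ j → Adj A (w (inject₁ j)) (w (suc j))) →
                x (w zero) ≡ x (w (fromℕ k))
    walk-flat zero    w adjacent = refl
    walk-flat (suc k) w adjacent = trans (walk-flat k (w ∘ inject₁) (adjacent ∘ inject₁)) (edge-flat (adjacent (fromℕ k)))

    constant : ∀ y y' → x y ≡ x y'
    constant y y' with k , w , refl , refl , adjacent ← proj₁ A-cactus y y' = walk-flat k w adjacent

open Dimension using (basis-size-unique; constant-basis; module Hyperplane)
open NetLaplacian using (Ker-ones; Ker-sub-*)

corollary3p6 : ∀ {n} (A : Mat n) → IsSignedGraph A → IsCactus A →
    ∀ (u v : Fin n) → Σ (Cycle A) (λ C → EdgeOf C u v) →
    ((∀ (C : Cycle A) → m⁺ C ≡ m⁻ C) →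
      ∀ k k' → HasNullity (netLaplacian A) k →
        HasNullity (netLaplacian (deleteEdge A u v)) k' → suc k' ≡ k)
    ×
    ((∀ (C : Cycle A) → m⁺ C ≢ m⁻ C) →
      ∀ k k' → HasNullity (netLaplacian A) k →
        HasNullity (netLaplacian (deleteEdge A u v)) k' → (k' ≡ k × k ≡ 1))
corollary3p6 A signed cactus u v (C , uv∈C) = balanced , unbalanced
  where
  open Cactus A signed cactus
  open CycleFacts C using (deleted-edge-ends; Ker-deleteEdge⇒Ker; module Balanced)
  open EdgeDeletion A u v using (Ker⇒Ker-deleteEdge)

  balanced : (∀ (C : Cycle A) → m⁺ C ≡ m⁻ C) → ∀ k k' → HasNullity (netLaplacian A) k →
             HasNullity (netLaplacian (deleteEdge A u v)) k' → suc k' ≡ k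
  balanced all-balanced k k' N N' = basis-size-unique
    (Hyperplane.extend-basis u v (Ker-deleteEdge⇒Ker uv∈C) (deleted-edge-ends uv∈C _) Ker⇒Ker-deleteEdge
       (Ker-sub-* A) Ker-potential (potential-separates uv∈C) N') N
    where open Balanced (all-balanced C)

  unbalanced : (∀ (C : Cycle A) → m⁺ C ≢ m⁻ C) → ∀ k k' → HasNullity (netLaplacian A) k →
               HasNullity (netLaplacian (deleteEdge A u v)) k' → k' ≡ k × k ≡ 1
  unbalanced all-unbalanced k k' N N' = trans k'≡1 (sym k≡1) , k≡1
    where
    open Unbalanced all-unbalanced
    k≡1 : k ≡ 1
    k≡1 = basis-size-unique N (constant-basis u (Ker-ones A) λ x Ax j → constant Ax j u)
    k'≡1 : k' ≡ 1
    k'≡1 = basis-size-unique N' (constant-basis u (Ker-ones (deleteEdge A u v))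
                                  λ x A'x j → constant (Ker-deleteEdge⇒Ker uv∈C A'x) j u)
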